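{- Let $q=(1+uy)/(1+y)$ and define $\eta_n(u,y)$ for $n\ge1$ recursively by \[\eta_n(u,y)=(1+y)^{\binom n2}(1+uy)^{\binom n2}-\sum_{k=1}^{n-1}\binom nk_q(1+uy)^{\binom{n-k}2}(1+y)^{(n-k)(n+k-1)/2}\eta_k(u,y).\] For $n\ge1$ let $t_n(u)=\sum_D u^{\operatorname{des}(D)}$, the sum over all strongly connected tournaments $D$ on $[n]$. Then for all $n\ge1$, \[\eta_n(y^{ -2},y)=(1+y)^{\binom n2}\,t_n(y^{ -1}).\]
   Context: A digraph on a finite set $V$ of integers is a set of ordered pairs $(s,t)\in V\times V$ with $s\neq t$. A tournament is a digraph with exactly one of $(s,t),(t,s)$ as an edge for each pair $s\ne t$. A digraph is strongly connected if for every two vertices $a,b$ there is a directed path from $a$ to $b$ (the empty path allowed when $a=b$). A descent is an edge $(s,t)$ with $s>t$; $\operatorname{des}(D)$ is the number of descents. $n!_q=\prod_{k=1}^n(1+q+\cdots+q^{k-1})$ and $\binom nk_q=\frac{n!_q}{k!_q(n-k)!_q}$. -}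

module Defs where

open import Data.Bool using (Bool; true; false; not)
import Data.Bool.Properties as BoolP
open import Data.Nat as ℕ using (ℕ; zero; suc; _∸_; _<ᵇ_)
import Data.Nat.DivMod
open import Data.Nat.Combinatorics using (_C_)
open import Data.Fin using (Fin; toℕ; _≟_)
open import Data.Fin.Properties using (all?)
open import Data.Vec as Vec using (Vec; []; _∷_; lookup)
open import Data.List as List using (List; []; _∷_; map; filter; concatMap; upTo)
open import Data.Rational as ℚ using (ℚ; 0ℚ; 1ℚ; _+_; _*_; _-_; _÷_; ≢-nonZero)
import Data.Rational.Properties as ℚP
open import Data.Product using (_×_)
open import Relation.Nullary using (Dec; yes; no; ¬_)
open import Relation.Nullary.Decidable using (_×-dec_; _→-dec_; ¬?)
open import Relation.Binary.PropositionalEquality using (_≡_; _≢_)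
open import Relation.Binary.Construct.Closure.ReflexiveTransitive using (Star)

_^ℚ_ : ℚ → ℕ → ℚ
x ^ℚ zero  = 1ℚ
x ^ℚ suc n = x * (x ^ℚ n)

-- division, with the (never used in the theorem) convention a / 0 = 0
_÷'_ : ℚ → ℚ → ℚ
a ÷' b with b ℚP.≟ 0ℚ
... | yes _  = 0ℚ
... | no b≢0 = _÷_ a b {{≢-nonZero b≢0}}

Σ[_]_ : List ℕ → (ℕ → ℚ) → ℚ
Σ[ ks ] f = List.foldr (λ k acc → f k + acc) 0ℚ ks

Π[_]_ : List ℕ → (ℕ → ℚ) → ℚ
Π[ ks ] f = List.foldr (λ k acc → f k * acc) 1ℚ ks

-- the list [a, a+1, ..., b] (empty if b < a)
[_⋯_] : ℕ → ℕ → List ℕ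
[ a ⋯ b ] = map (a ℕ.+_) (upTo (suc b ∸ a))

qint : ℚ → ℕ → ℚ
qint q k = Σ[ upTo k ] (λ i → q ^ℚ i)

qfact : ℚ → ℕ → ℚ
qfact q n = Π[ [ 1 ⋯ n ] ] (qint q)

qbinom : ℚ → ℕ → ℕ → ℚ
qbinom q n k = qfact q n ÷' (qfact q k * qfact q (n ∸ k))

-- η_n(u,y), defined by the recursion of the paper.
-- etaF is the recursion with a fuel argument; with fuel ≥ n it computes
-- η_n (each recursive call is at k ≤ n-1 with fuel decreased by one).

module _ (u y : ℚ) where

  q : ℚ
  q = (1ℚ + u * y) ÷' (1ℚ + y)

  etaF : ℕ → ℕ → ℚ
  etaF zero    n = 0ℚ
  etaF (suc f) n =
    ((1ℚ + y) ^ℚ (n C 2)) * ((1ℚ + u * y) ^ℚ (n C 2))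
    - Σ[ [ 1 ⋯ n ∸ 1 ] ] (λ k →
        qbinom q n k
        * ((1ℚ + u * y) ^ℚ ((n ∸ k) C 2))
        * ((1ℚ + y) ^ℚ (((n ∸ k) ℕ.* (n ℕ.+ k ∸ 1)) Data.Nat.DivMod./ 2))
        * etaF f k)

  η : ℕ → ℚ
  η n = etaF n n

-- Digraphs on [n] = {1,...,n}, represented on Fin n (vertex i ↔ integer i+1,
-- order-preservingly). D i j ≡ true means (i,j) is an edge.

Digraph : ℕ → Set
Digraph n = Fin n → Fin n → Bool

Edge : ∀ {n} → Digraph n → Fin n → Fin n → Set
Edge D i j = D i j ≡ true

IsTournament : ∀ {n} → Digraph n → Set
IsTournament D = (∀ i → D i i ≡ false) × (∀ i j → i ≢ j → D i j ≡ not (D j i))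

isTournament? : ∀ {n} (D : Digraph n) → Dec (IsTournament D)
isTournament? D =
  all? (λ i → D i i BoolP.≟ false)
  ×-dec all? (λ i → all? (λ j → ¬? (i ≟ j) →-dec (D i j BoolP.≟ not (D j i))))

StronglyConnected : ∀ {n} → Digraph n → Set
StronglyConnected D = ∀ a b → Star (Edge D) a b

des : ∀ {n} → Digraph n → ℕ
des {n} D = List.length (filter (λ p → Data.Bool.T? (isDesc p)) (List.cartesianProduct (List.allFin n) (List.allFin n)))
  where
  open import Data.Product using (_,_)
  isDesc : _ → Bool
  isDesc (s , t) = (toℕ t <ᵇ toℕ s) Data.Bool.∧ D s t

allVecs : ∀ {A : Set} (n : ℕ) → List A → List (Vec A n)
allVecs zero    xs = [] ∷ []
allVecs (suc n) xs = concatMap (λ x → map (x ∷_) (allVecs n xs)) xs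

allDigraphs : (n : ℕ) → List (Digraph n)
allDigraphs n = map (λ m i j → lookup (lookup m i) j) (allVecs n (allVecs n (true ∷ false ∷ [])))

-- Strong connectivity is a proposition; the sum is parametrised by a decision
-- procedure for it (any two such procedures give the same value).
t : (sc? : ∀ {n} (D : Digraph n) → Dec (StronglyConnected D)) → ℕ → ℚ → ℚ
t sc? n u = List.foldr (λ D acc → (u ^ℚ des D) + acc) 0ℚ
  (filter (λ D → isTournament? D ×-dec sc? D) (allDigraphs n))

-- Write w = 1/y. Then u = w², q = w and 1 + u y = 1 + w, and by induction on n the claim
-- η_n = (1+y)^C(n,2) t_n(w) reduces the recursion to the identity
--   (1+w)^C(n,2) = Σ_{k=1}^{n} [n k]_w (1+w)^C(n-k,2) t_k(w).
-- The left side is the descent generating function of all tournaments on [n]. Every tournament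
-- has exactly one source component: a nonempty vertex set S that no edge enters and on which the
-- tournament is strongly connected. A tournament with source component S of size k is a strongly
-- connected tournament on S, an arbitrary tournament on the complement, and edges from S to the
-- complement, of which exactly the inversions of S are descents; and Σ_{|S|=k} w^inv(S) = [n k]_w.

module Submission where

open import Defs
open import Data.Bool as B using (Bool; true; false; not; _∧_; _∨_; _xor_; if_then_else_)
import Data.Bool.Properties as BP
open import Data.Nat as ℕ using (ℕ; zero; suc; _∸_; _≤_; _<_; z≤n; s≤s; _<ᵇ_)
import Data.Nat.Properties as ℕP
import Data.Nat.DivMod as DM
open import Data.Nat.Combinatorics using (_C_; nCk+nC[k+1]≡[n+1]C[k+1]; nC1≡n)
open import Data.Fin as F using (Fin; zero; suc; toℕ)
import Data.Fin.Properties as FP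
open import Data.Vec as V using (Vec; []; _∷_; lookup; replicate)
import Data.Vec.Properties as VP
open import Data.List as L using (List; []; _∷_; upTo; _++_; applyUpTo)
import Data.List.Properties as LP
open import Data.Rational as ℚ using (ℚ; 0ℚ; 1ℚ; _+_; _*_; -_; _-_; ∣_∣; 1/_)
import Data.Rational.Properties as ℚP
open import Data.Product using (Σ; _×_; _,_; proj₁; proj₂)
open import Data.Sum using (inj₁; inj₂)
open import Data.Empty using (⊥; ⊥-elim)
open import Relation.Binary.PropositionalEquality
open import Relation.Nullary using (Dec; yes; no; does; ¬_)
open import Relation.Nullary.Decidable using (dec-true; dec-false; _×-dec_)
open import Relation.Binary using (tri<; tri≈; tri>)
open import Relation.Binary.Construct.Closure.ReflexiveTransitive using (Star; ε; _◅_; _◅◅_; gmap)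
import Data.Nat.Tactic.RingSolver as ℕSolver
open import Data.Rational.Solver using (module +-*-Solver)
open +-*-Solver
open import Algebra.Bundles using (CommutativeMonoid)
open import Algebra.Properties.CommutativeSemigroup (CommutativeMonoid.commutativeSemigroup ℚP.+-0-commutativeMonoid)
  using (interchange)
open import Algebra.Properties.CommutativeSemigroup ℕP.+-commutativeSemigroup using ()
  renaming (interchange to ℕ+-interchange)

not-true⇒false : ∀ {b} → not b ≡ true → b ≡ false
not-true⇒false {b} = BP.not-injective {b} {false}

true≢false : true ≢ false
true≢false ()

dec-witness : ∀ {A : Set} (a? : Dec A) → does a? ≡ true → A
dec-witness (yes a) _ = a

∨-introˡ : ∀ {a} c → a ≡ true → a ∨ c ≡ true
∨-introˡ c refl = refl

∨-introʳ : ∀ a {c} → c ≡ true → a ∨ c ≡ true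
∨-introʳ a refl = BP.∨-zeroʳ a

+-identityˡ-when-zero : ∀ {a} x → a ≡ 0ℚ → a + x ≡ x
+-identityˡ-when-zero x p = trans (cong (_+ x) p) (ℚP.+-identityˡ x)

+-identityʳ-when-zero : ∀ {a} x → a ≡ 0ℚ → x + a ≡ x
+-identityʳ-when-zero x p = trans (cong (x +_) p) (ℚP.+-identityʳ x)

infixr 8 [_]·_

[_]·_ : Bool → ℚ → ℚ
[ true  ]· x = x
[ false ]· x = 0ℚ

[]·-∧ : ∀ a b x → [ a ∧ b ]· x ≡ [ a ]· [ b ]· x
[]·-∧ true  b x = refl
[]·-∧ false b x = refl

[]·-* : ∀ a c x → [ a ]· (c * x) ≡ c * [ a ]· x
[]·-* true  c x = refl
[]·-* false c x = sym (ℚP.*-zeroʳ c)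

*-[]·1 : ∀ b x → x * [ b ]· 1ℚ ≡ [ b ]· x
*-[]·1 true  x = ℚP.*-identityʳ x
*-[]·1 false x = ℚP.*-zeroʳ x

[]·-congʳ : ∀ b {x y} → (b ≡ true → x ≡ y) → [ b ]· x ≡ [ b ]· y
[]·-congʳ true  e = e refl
[]·-congʳ false e = refl

[]·-0 : ∀ b → [ b ]· 0ℚ ≡ 0ℚ
[]·-0 true  = refl
[]·-0 false = refl

record Linear {X : Set} (S : (X → ℚ) → ℚ) : Set where
  field
    pointwise   : ∀ {f g} → (∀ x → f x ≡ g x) → S f ≡ S g
    additive    : ∀ f g → S (λ x → f x + g x) ≡ S f + S g
    homogeneous : ∀ c f → S (λ x → c * f x) ≡ c * S f

  vanishes : S (λ _ → 0ℚ) ≡ 0ℚ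
  vanishes = begin
    S (λ _ → 0ℚ)        ≡⟨ pointwise (λ _ → sym (ℚP.*-zeroˡ 0ℚ)) ⟩
    S (λ _ → 0ℚ * 0ℚ)   ≡⟨ homogeneous 0ℚ (λ _ → 0ℚ) ⟩
    0ℚ * S (λ _ → 0ℚ)   ≡⟨ ℚP.*-zeroˡ (S (λ _ → 0ℚ)) ⟩
    0ℚ                  ∎
    where open ≡-Reasoning

  homogeneousʳ : ∀ c f → S (λ x → f x * c) ≡ S f * c
  homogeneousʳ c f =
    trans (pointwise (λ x → ℚP.*-comm (f x) c)) (trans (homogeneous c f) (ℚP.*-comm c _))

  pull-[]· : ∀ b f → S (λ x → [ b ]· f x) ≡ [ b ]· S f
  pull-[]· true  f = refl
  pull-[]· false f = vanishes

open Linear public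

Interchanges : {X : Set} → ((X → ℚ) → ℚ) → Set₁
Interchanges {X} S = ∀ {Y : Set} {T : (Y → ℚ) → ℚ} → Linear T →
  (f : X → Y → ℚ) → S (λ x → T (f x)) ≡ T (λ y → S (λ x → f x y))

module _ {X Y Z : Set} {S : (X → ℚ) → ℚ} {T : (Y → ℚ) → ℚ} (g : X → Y → Z) where

  linear-nested : Linear S → Linear T → Linear (λ f → S (λ x → T (λ y → f (g x y))))
  pointwise   (linear-nested LS LT) e = pointwise LS (λ x → pointwise LT (λ y → e (g x y)))
  additive    (linear-nested LS LT) f h =
    trans (pointwise LS (λ x → additive LT (λ y → f (g x y)) (λ y → h (g x y))))
          (additive LS _ _)
  homogeneous (linear-nested LS LT) c f =
    trans (pointwise LS (λ x → homogeneous LT c (λ y → f (g x y)))) (homogeneous LS c _)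

  interchanges-nested : Linear S → Interchanges S → Interchanges T →
    Interchanges (λ f → S (λ x → T (λ y → f (g x y))))
  interchanges-nested LS IS IT LU f =
    trans (pointwise LS (λ x → IT LU (λ y → f (g x y)))) (IS LU _)

ΣBool : (Bool → ℚ) → ℚ
ΣBool f = f true + f false

linear-ΣBool : Linear ΣBool
pointwise   linear-ΣBool e = cong₂ _+_ (e true) (e false)
additive    linear-ΣBool f g = interchange (f true) (g true) (f false) (g false)
homogeneous linear-ΣBool c f = sym (ℚP.*-distribˡ-+ c (f true) (f false))

interchanges-ΣBool : Interchanges ΣBool
interchanges-ΣBool LT f = sym (additive LT _ _)

ΣPow : ∀ {X : Set} → ((X → ℚ) → ℚ) → (n : ℕ) → (Vec X n → ℚ) → ℚ
ΣPow S zero    f = f []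
ΣPow S (suc n) f = S (λ x → ΣPow S n (λ v → f (x ∷ v)))

module _ {X : Set} {S : (X → ℚ) → ℚ} (LS : Linear S) where

  linear-ΣPow : ∀ n → Linear (ΣPow S n)
  linear-ΣPow zero    = record { pointwise = λ e → e [] ; additive = λ _ _ → refl ; homogeneous = λ _ _ → refl }
  linear-ΣPow (suc n) = linear-nested _∷_ LS (linear-ΣPow n)

  interchanges-ΣPow : Interchanges S → ∀ n → Interchanges (ΣPow S n)
  interchanges-ΣPow IS zero    LT f = refl
  interchanges-ΣPow IS (suc n) = interchanges-nested {S = S} {T = ΣPow S n} _∷_ LS IS (interchanges-ΣPow IS n)

ΣVec : (n : ℕ) → (Vec Bool n → ℚ) → ℚ
ΣVec = ΣPow ΣBool

linear-ΣVec : ∀ n → Linear (ΣVec n)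
linear-ΣVec = linear-ΣPow linear-ΣBool

interchanges-ΣVec : ∀ n → Interchanges (ΣVec n)
interchanges-ΣVec = interchanges-ΣPow linear-ΣBool interchanges-ΣBool

ΣL : ∀ {X : Set} → List X → (X → ℚ) → ℚ
ΣL xs f = L.foldr (λ x acc → f x + acc) 0ℚ xs

linear-ΣL : ∀ {X : Set} (xs : List X) → Linear (ΣL xs)
pointwise   (linear-ΣL [])       e = refl
pointwise   (linear-ΣL (x ∷ xs)) e = cong₂ _+_ (e x) (pointwise (linear-ΣL xs) e)
additive    (linear-ΣL [])       f g = sym (ℚP.+-identityˡ 0ℚ)
additive    (linear-ΣL (x ∷ xs)) f g =
  trans (cong ((f x + g x) +_) (additive (linear-ΣL xs) f g))
        (interchange (f x) (g x) (ΣL xs f) (ΣL xs g))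
homogeneous (linear-ΣL [])       c f = sym (ℚP.*-zeroʳ c)
homogeneous (linear-ΣL (x ∷ xs)) c f =
  trans (cong ((c * f x) +_) (homogeneous (linear-ΣL xs) c f))
        (sym (ℚP.*-distribˡ-+ c (f x) (ΣL xs f)))

ΣL-map : ∀ {X Y : Set} (g : X → Y) xs (f : Y → ℚ) → ΣL (L.map g xs) f ≡ ΣL xs (λ x → f (g x))
ΣL-map g []       f = refl
ΣL-map g (x ∷ xs) f = cong (f (g x) +_) (ΣL-map g xs f)

ΣL-++ : ∀ {X : Set} (xs ys : List X) f → ΣL (xs ++ ys) f ≡ ΣL xs f + ΣL ys f
ΣL-++ []       ys f = sym (ℚP.+-identityˡ _)
ΣL-++ (x ∷ xs) ys f = trans (cong (f x +_) (ΣL-++ xs ys f)) (sym (ℚP.+-assoc (f x) _ _))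

Σ[]-upTo-suc : ∀ N (f : ℕ → ℚ) → Σ[ upTo (suc N) ] f ≡ Σ[ upTo N ] f + f N
Σ[]-upTo-suc N f = trans (cong (λ l → Σ[ l ] f) (sym (LP.upTo-∷ʳ N)))
  (trans (ΣL-++ (upTo N) (N ∷ []) f) (cong (Σ[ upTo N ] f +_) (ℚP.+-identityʳ (f N))))

Σ[]-applyUpTo-suc : ∀ N (f : ℕ → ℚ) → Σ[ applyUpTo suc N ] f ≡ Σ[ upTo N ] (λ k → f (suc k))
Σ[]-applyUpTo-suc N f = trans (cong (λ l → Σ[ l ] f) (sym (LP.map-upTo suc N))) (ΣL-map suc (upTo N) f)

Σ[]-upTo-delta : ∀ N m (g : ℕ → ℚ) → m < N → Σ[ upTo N ] (λ k → [ does (m ℕP.≟ k) ]· g k) ≡ g m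
Σ[]-upTo-delta (suc N) zero    g _ = +-identityʳ-when-zero (g 0)
  (trans (Σ[]-applyUpTo-suc N (λ k → [ does (0 ℕP.≟ k) ]· g k)) (vanishes (linear-ΣL (upTo N))))
Σ[]-upTo-delta (suc N) (suc m) g (s≤s m<N) = trans (ℚP.+-identityˡ _)
  (trans (Σ[]-applyUpTo-suc N (λ k → [ does (suc m ℕP.≟ k) ]· g k)) (Σ[]-upTo-delta N m (λ k → g (suc k)) m<N))

extend : ∀ {n} → Bool → Vec Bool n → Vec Bool n → Digraph n → Digraph (suc n)
extend b r c D zero    zero    = b
extend b r c D zero    (suc j) = lookup r j
extend b r c D (suc i) zero    = lookup c i
extend b r c D (suc i) (suc j) = D i j

tail : ∀ {n} → Digraph (suc n) → Digraph n
tail D i j = D (suc i) (suc j)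

emptyDigraph : Digraph 0
emptyDigraph ()

ΣDigraph : (n : ℕ) → (Digraph n → ℚ) → ℚ
ΣDigraph zero    f = f emptyDigraph
ΣDigraph (suc n) f =
  ΣBool λ b → ΣVec n λ r → ΣVec n λ c → ΣDigraph n λ D → f (extend b r c D)

private
  Extension : ℕ → Set
  Extension n = Vec Bool n × Vec Bool n × Digraph n

  extend′ : ∀ {n} → Bool → Extension n → Digraph (suc n)
  extend′ b x = extend b (proj₁ x) (proj₁ (proj₂ x)) (proj₂ (proj₂ x))

  ΣExtension : ∀ n → (Extension n → ℚ) → ℚ
  ΣExtension n h = ΣVec n λ r → ΣVec n λ c → ΣDigraph n λ D → h (r , c , D)

linear-ΣDigraph : ∀ n → Linear (ΣDigraph n)
linear-ΣDigraph zero    = record { pointwise = λ e → e emptyDigraph ; additive = λ _ _ → refl ; homogeneous = λ _ _ → refl }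
linear-ΣDigraph (suc n) = linear-nested {S = ΣBool} {T = ΣExtension n} extend′ linear-ΣBool
  (linear-nested _,_ (linear-ΣVec n) (linear-nested _,_ (linear-ΣVec n) (linear-ΣDigraph n)))

interchanges-ΣDigraph : ∀ n → Interchanges (ΣDigraph n)
interchanges-ΣDigraph zero    LT f = refl
interchanges-ΣDigraph (suc n) = interchanges-nested {S = ΣBool} {T = ΣExtension n} extend′
  linear-ΣBool interchanges-ΣBool
  (interchanges-nested {S = ΣVec n} {T = λ h → ΣVec n λ c → ΣDigraph n λ D → h (c , D)} _,_
    (linear-ΣVec n) (interchanges-ΣVec n)
    (interchanges-nested {S = ΣVec n} {T = ΣDigraph n} _,_
      (linear-ΣVec n) (interchanges-ΣVec n) (interchanges-ΣDigraph n)))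

allFin : ∀ n → (Fin n → Bool) → Bool
allFin zero    f = true
allFin (suc n) f = f zero ∧ allFin n (λ i → f (suc i))

allFin-sound : ∀ n (f : Fin n → Bool) → allFin n f ≡ true → ∀ i → f i ≡ true
allFin-sound (suc n) f p zero    = BP.∧-conicalˡ (f zero) _ p
allFin-sound (suc n) f p (suc i) = allFin-sound n (λ i → f (suc i)) (BP.∧-conicalʳ (f zero) _ p) i

allFin-complete : ∀ n (f : Fin n → Bool) → (∀ i → f i ≡ true) → allFin n f ≡ true
allFin-complete zero    f h = refl
allFin-complete (suc n) f h =
  cong₂ _∧_ (h zero) (allFin-complete n (λ i → f (suc i)) (λ i → h (suc i)))

countFin : ∀ n → (Fin n → Bool) → ℕ
countFin zero    f = 0
countFin (suc n) f = (if f zero then 1 else 0) ℕ.+ countFin n (λ i → f (suc i))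

isTournamentᵇ : ∀ {n} → Digraph n → Bool
isTournamentᵇ {zero}  D = true
isTournamentᵇ {suc n} D =
  not (D zero zero) ∧ (allFin n (λ j → D zero (suc j) xor D (suc j) zero) ∧ isTournamentᵇ (tail D))

descents : ∀ {n} → Digraph n → ℕ
descents {zero}  D = 0
descents {suc n} D = countFin n (λ i → D (suc i) zero) ℕ.+ descents (tail D)

isTournamentᵇ-sound : ∀ {n} (D : Digraph n) → isTournamentᵇ D ≡ true → IsTournament D
isTournamentᵇ-sound {zero}  D p = (λ ()) , (λ ())
isTournamentᵇ-sound {suc n} D p = irreflexive , antisymmetric
  where
  edges-from-0 : allFin n (λ j → D zero (suc j) xor D (suc j) zero) ∧ isTournamentᵇ (tail D) ≡ true
  edges-from-0 = BP.∧-conicalʳ (not (D zero zero)) _ p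
  loopless : not (D zero zero) ≡ true
  loopless = BP.∧-conicalˡ (not (D zero zero)) _ p
  opposite : allFin n (λ j → D zero (suc j) xor D (suc j) zero) ≡ true
  opposite = BP.∧-conicalˡ _ _ edges-from-0
  rest : IsTournament (tail D)
  rest = isTournamentᵇ-sound (tail D) (BP.∧-conicalʳ (allFin n _) _ edges-from-0)
  xor⇒≡not : ∀ a b → a xor b ≡ true → a ≡ not b
  xor⇒≡not true  false _ = refl
  xor⇒≡not false true  _ = refl
  irreflexive : ∀ i → D i i ≡ false
  irreflexive zero    = not-true⇒false loopless
  irreflexive (suc i) = proj₁ rest i
  antisymmetric : ∀ i j → i ≢ j → D i j ≡ not (D j i)
  antisymmetric zero    zero    i≢j = ⊥-elim (i≢j refl)
  antisymmetric zero    (suc j) _   = xor⇒≡not _ _ (allFin-sound n _ opposite j)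
  antisymmetric (suc i) zero    _   =
    xor⇒≡not _ _ (trans (BP.xor-comm (D (suc i) zero) (D zero (suc i))) (allFin-sound n _ opposite i))
  antisymmetric (suc i) (suc j) i≢j = proj₂ rest i j (λ i≡j → i≢j (cong suc i≡j))

isTournamentᵇ-complete : ∀ {n} (D : Digraph n) → IsTournament D → isTournamentᵇ D ≡ true
isTournamentᵇ-complete {zero}  D _ = refl
isTournamentᵇ-complete {suc n} D (irreflexive , antisymmetric) =
  cong₂ _∧_ (cong not (irreflexive zero))
    (cong₂ _∧_ (allFin-complete n _ (λ j → ≡not⇒xor (antisymmetric zero (suc j) (λ ()))))
               (isTournamentᵇ-complete (tail D) ((λ i → irreflexive (suc i))
                 , (λ i j i≢j → antisymmetric (suc i) (suc j) (λ e → i≢j (FP.suc-injective e))))))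
  where
  ≡not⇒xor : ∀ {a b} → a ≡ not b → a xor b ≡ true
  ≡not⇒xor {true}  {false} _ = refl
  ≡not⇒xor {false} {true}  _ = refl

Extensional : ∀ {A : Set} {n} → (Digraph n → A) → Set
Extensional {n = n} F = ∀ (D D′ : Digraph n) → (∀ i j → D i j ≡ D′ i j) → F D ≡ F D′

-- Vertex subsets as Boolean vectors

size : ∀ {n} → Vec Bool n → ℕ
size []          = 0
size (true  ∷ v) = suc (size v)
size (false ∷ v) = size v

cosize : ∀ {n} → Vec Bool n → ℕ
cosize []          = 0
cosize (true  ∷ v) = cosize v
cosize (false ∷ v) = suc (cosize v)

-- pairs i < j with i ∉ s and j ∈ s: the descents between a closed set s and its complement
inversions : ∀ {n} → Vec Bool n → ℕ
inversions []          = 0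
inversions (true  ∷ s) = inversions s
inversions (false ∷ s) = size s ℕ.+ inversions s

-- no edge enters s from outside
closedᵇ : ∀ {n} → Vec Bool n → Digraph n → Bool
closedᵇ []                D = true
closedᵇ {suc n} (true  ∷ s) D =
  allFin n (λ i → lookup s i ∨ not (D (suc i) zero)) ∧ closedᵇ s (tail D)
closedᵇ {suc n} (false ∷ s) D =
  allFin n (λ j → not (lookup s j) ∨ not (D zero (suc j))) ∧ closedᵇ s (tail D)

embed : ∀ {n} (s : Vec Bool n) → Fin (size s) → Fin n
embed (true  ∷ s) zero    = zero
embed (true  ∷ s) (suc i) = suc (embed s i)
embed (false ∷ s) i       = suc (embed s i)

restrict : ∀ {n} (s : Vec Bool n) → Digraph n → Digraph (size s)
restrict s D i j = D (embed s i) (embed s j)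

merge : ∀ {n} (s : Vec Bool n) → Vec Bool (size s) → Vec Bool (cosize s) → Vec Bool n
merge []          []      []      = []
merge (true  ∷ s) (x ∷ a) b       = x ∷ merge s a b
merge (false ∷ s) a       (x ∷ b) = x ∷ merge s a b

allFalse : ∀ {n} → Vec Bool n → Bool
allFalse []      = true
allFalse (x ∷ v) = not x ∧ allFalse v

allTrue : ∀ {n} → Vec Bool n → Bool
allTrue []      = true
allTrue (x ∷ v) = x ∧ allTrue v

triangle : ℕ → ℕ
triangle zero    = 0
triangle (suc m) = m ℕ.+ triangle m

^ℚ-distribˡ-+-* : ∀ x a b → x ^ℚ (a ℕ.+ b) ≡ (x ^ℚ a) * (x ^ℚ b)
^ℚ-distribˡ-+-* x zero    b = sym (ℚP.*-identityˡ _)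
^ℚ-distribˡ-+-* x (suc a) b =
  trans (cong (x *_) (^ℚ-distribˡ-+-* x a b)) (sym (ℚP.*-assoc x _ _))

countFin-lookup : ∀ {n} (c : Vec Bool n) → countFin n (lookup c) ≡ size c
countFin-lookup []          = refl
countFin-lookup (true  ∷ c) = cong suc (countFin-lookup c)
countFin-lookup (false ∷ c) = countFin-lookup c

descents-extend : ∀ {n} b r c (D : Digraph n) → descents (extend b r c D) ≡ size c ℕ.+ descents D
descents-extend b r c D = cong (ℕ._+ descents D) (countFin-lookup c)

extend-extensional : ∀ {n} b r c {D D′ : Digraph n} → (∀ i j → D i j ≡ D′ i j) →
                     ∀ i j → extend b r c D i j ≡ extend b r c D′ i j
extend-extensional b r c e zero    zero    = refl
extend-extensional b r c e zero    (suc j) = refl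
extend-extensional b r c e (suc i) zero    = refl
extend-extensional b r c e (suc i) (suc j) = e i j

size-replicate-true : ∀ m → size (replicate m true) ≡ m
size-replicate-true zero    = refl
size-replicate-true (suc m) = cong suc (size-replicate-true m)

size-replicate-false : ∀ m → size (replicate m false) ≡ 0
size-replicate-false zero    = refl
size-replicate-false (suc m) = size-replicate-false m

closedᵇ-replicate-false : ∀ n (D : Digraph n) → closedᵇ (replicate n false) D ≡ true
closedᵇ-replicate-false zero    D = refl
closedᵇ-replicate-false (suc n) D = cong₂ _∧_
  (allFin-complete n _ (λ j → cong (λ b → not b ∨ not (D zero (suc j))) (VP.lookup-replicate j false)))
  (closedᵇ-replicate-false n (tail D))

inversions-replicate-false : ∀ n → inversions (replicate n false) ≡ 0
inversions-replicate-false zero    = refl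
inversions-replicate-false (suc n) = cong₂ ℕ._+_ (size-replicate-false n) (inversions-replicate-false n)

cosize-replicate-false : ∀ n → cosize (replicate n false) ≡ n
cosize-replicate-false zero    = refl
cosize-replicate-false (suc n) = cong suc (cosize-replicate-false n)

size-merge : ∀ {n} (s : Vec Bool n) a b → size (merge s a b) ≡ size a ℕ.+ size b
size-merge []          []          []          = refl
size-merge (true  ∷ s) (true  ∷ a) b           = cong suc (size-merge s a b)
size-merge (true  ∷ s) (false ∷ a) b           = size-merge s a b
size-merge (false ∷ s) a           (true  ∷ b) =
  trans (cong suc (size-merge s a b)) (sym (ℕP.+-suc (size a) (size b)))
size-merge (false ∷ s) a           (false ∷ b) = size-merge s a b

lookup-merge-embed : ∀ {n} (s : Vec Bool n) a b i → lookup (merge s a b) (embed s i) ≡ lookup a i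
lookup-merge-embed (true  ∷ s) (x ∷ a) b       zero    = refl
lookup-merge-embed (true  ∷ s) (x ∷ a) b       (suc i) = lookup-merge-embed s a b i
lookup-merge-embed (false ∷ s) a       (x ∷ b) i       = lookup-merge-embed s a b i

allFin-outside-merge : ∀ {n} (s : Vec Bool n) a b →
  allFin n (λ i → lookup s i ∨ not (lookup (merge s a b) i)) ≡ allFalse b
allFin-outside-merge []          []      []      = refl
allFin-outside-merge (true  ∷ s) (x ∷ a) b       = allFin-outside-merge s a b
allFin-outside-merge (false ∷ s) a       (x ∷ b) = cong (not x ∧_) (allFin-outside-merge s a b)

allFin-inside-complement-merge : ∀ {n} (s : Vec Bool n) a b →
  allFin n (λ j → not (lookup s j) ∨ not (lookup (V.map not (merge s a b)) j)) ≡ allTrue a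
allFin-inside-complement-merge []          []          []      = refl
allFin-inside-complement-merge (true  ∷ s) (true  ∷ a) b       = allFin-inside-complement-merge s a b
allFin-inside-complement-merge (true  ∷ s) (false ∷ a) b       = refl
allFin-inside-complement-merge (false ∷ s) a           (x ∷ b) = allFin-inside-complement-merge s a b

ΣVec-merge : ∀ {n} (s : Vec Bool n) (g : Vec Bool n → ℚ) →
  ΣVec n g ≡ ΣVec (size s) (λ a → ΣVec (cosize s) (λ b → g (merge s a b)))
ΣVec-merge []          g = refl
ΣVec-merge (true  ∷ s) g =
  cong₂ _+_ (ΣVec-merge s (λ v → g (true ∷ v))) (ΣVec-merge s (λ v → g (false ∷ v)))
ΣVec-merge (false ∷ s) g =
  trans (cong₂ _+_ (ΣVec-merge s (λ v → g (true ∷ v))) (ΣVec-merge s (λ v → g (false ∷ v))))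
        (sym (additive (linear-ΣVec (size s)) (λ a → ΣVec _ (λ b → g (true ∷ merge s a b)))
                                              (λ a → ΣVec _ (λ b → g (false ∷ merge s a b)))))

ΣVec-select-complement : ∀ n (c : Vec Bool n) (h : Vec Bool n → ℚ) →
  ΣVec n (λ r → [ allFin n (λ j → lookup r j xor lookup c j) ]· h r) ≡ h (V.map not c)
ΣVec-select-complement zero    []          h = refl
ΣVec-select-complement (suc n) (true  ∷ c) h =
  trans (+-identityˡ-when-zero _ (vanishes (linear-ΣVec n)))
        (ΣVec-select-complement n c (λ v → h (false ∷ v)))
ΣVec-select-complement (suc n) (false ∷ c) h =
  trans (+-identityʳ-when-zero _ (vanishes (linear-ΣVec n)))
        (ΣVec-select-complement n c (λ v → h (true ∷ v)))

ΣVec-select-allFalse : ∀ n (h : Vec Bool n → ℚ) → ΣVec n (λ v → [ allFalse v ]· h v) ≡ h (replicate n false)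
ΣVec-select-allFalse zero    h = refl
ΣVec-select-allFalse (suc n) h =
  trans (+-identityˡ-when-zero _ (vanishes (linear-ΣVec n))) (ΣVec-select-allFalse n (λ v → h (false ∷ v)))

ΣVec-select-allTrue : ∀ n (h : Vec Bool n → ℚ) → ΣVec n (λ v → [ allTrue v ]· h v) ≡ h (replicate n true)
ΣVec-select-allTrue zero    h = refl
ΣVec-select-allTrue (suc n) h =
  trans (+-identityʳ-when-zero _ (vanishes (linear-ΣVec n))) (ΣVec-select-allTrue n (λ v → h (true ∷ v)))

ΣVec-unique : ∀ n (S₀ : Vec Bool n) (f : Vec Bool n → ℚ) → (∀ S → S ≢ S₀ → f S ≡ 0ℚ) → ΣVec n f ≡ f S₀
ΣVec-unique zero    []           f h = refl
ΣVec-unique (suc n) (true  ∷ S₀) f h =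
  trans (+-identityʳ-when-zero _ (trans (pointwise (linear-ΣVec n) (λ v → h (false ∷ v) (λ ()))) (vanishes (linear-ΣVec n))))
        (ΣVec-unique n S₀ (λ v → f (true ∷ v)) (λ S S≢S₀ → h (true ∷ S) (λ e → S≢S₀ (VP.∷-injectiveʳ e))))
ΣVec-unique (suc n) (false ∷ S₀) f h =
  trans (+-identityˡ-when-zero _ (trans (pointwise (linear-ΣVec n) (λ v → h (true ∷ v) (λ ()))) (vanishes (linear-ΣVec n))))
        (ΣVec-unique n S₀ (λ v → f (false ∷ v)) (λ S S≢S₀ → h (false ∷ S) (λ e → S≢S₀ (VP.∷-injectiveʳ e))))

attach : ∀ {n} → Vec Bool n → Digraph n → Digraph (suc n)
attach c D = extend false (V.map not c) c D

restrict-attach-merge : ∀ {n} (s : Vec Bool n) a b (D : Digraph n) → ∀ i j →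
  restrict (true ∷ s) (attach (merge s a b) D) i j ≡ attach a (restrict s D) i j
restrict-attach-merge s a b D zero    zero    = refl
restrict-attach-merge s a b D zero    (suc j) =
  trans (VP.lookup-map (embed s j) not (merge s a b))
        (trans (cong not (lookup-merge-embed s a b j)) (sym (VP.lookup-map j not a)))
restrict-attach-merge s a b D (suc i) zero    = lookup-merge-embed s a b i
restrict-attach-merge s a b D (suc i) (suc j) = refl

ΣDigraph-tournaments-attach : ∀ n (F : Digraph (suc n) → ℚ) →
  ΣDigraph (suc n) (λ D → [ isTournamentᵇ D ]· F D)
  ≡ ΣVec n (λ c → ΣDigraph n (λ D → [ isTournamentᵇ D ]· F (attach c D)))
ΣDigraph-tournaments-attach n F = begin
  ΣDigraph (suc n) (λ D → [ isTournamentᵇ D ]· F D)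
    ≡⟨ +-identityˡ-when-zero _ loopless ⟩
  ΣVec n (λ r → ΣVec n (λ c → ΣDigraph n (λ D → [ opposite r c ∧ isTournamentᵇ D ]· F (extend false r c D))))
    ≡⟨ interchanges-ΣVec n (linear-ΣVec n)
         (λ r c → ΣDigraph n (λ D → [ opposite r c ∧ isTournamentᵇ D ]· F (extend false r c D))) ⟩
  ΣVec n (λ c → ΣVec n (λ r → ΣDigraph n (λ D → [ opposite r c ∧ isTournamentᵇ D ]· F (extend false r c D))))
    ≡⟨ pointwise (linear-ΣVec n) (λ c → trans (pointwise (linear-ΣVec n) (λ r → select r c))
         (ΣVec-select-complement n c (λ r → ΣDigraph n (λ D → [ isTournamentᵇ D ]· F (extend false r c D))))) ⟩
  ΣVec n (λ c → ΣDigraph n (λ D → [ isTournamentᵇ D ]· F (attach c D))) ∎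
  where
  open ≡-Reasoning
  opposite : Vec Bool n → Vec Bool n → Bool
  opposite r c = allFin n (λ j → lookup r j xor lookup c j)
  loopless : ΣVec n (λ r → ΣVec n (λ c → ΣDigraph n (λ D →
               [ isTournamentᵇ (extend true r c D) ]· F (extend true r c D)))) ≡ 0ℚ
  loopless = trans (pointwise (linear-ΣVec n) (λ r →
               trans (pointwise (linear-ΣVec n) (λ c → vanishes (linear-ΣDigraph n))) (vanishes (linear-ΣVec n))))
             (vanishes (linear-ΣVec n))
  select : ∀ r c → ΣDigraph n (λ D → [ opposite r c ∧ isTournamentᵇ D ]· F (extend false r c D))
                 ≡ [ opposite r c ]· ΣDigraph n (λ D → [ isTournamentᵇ D ]· F (extend false r c D))
  select r c = trans (pointwise (linear-ΣDigraph n) (λ D → []·-∧ (opposite r c) (isTournamentᵇ D) _))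
                     (pull-[]· (linear-ΣDigraph n) (opposite r c) _)

module _ (w : ℚ) where
  open ≡-Reasoning

  tournamentSum : ∀ k → (Digraph k → Bool) → ℚ
  tournamentSum k P = ΣDigraph k (λ A → [ isTournamentᵇ A ∧ P A ]· w ^ℚ descents A)

  tournamentSum-cong : ∀ k {P Q : Digraph k → Bool} → (∀ A → P A ≡ Q A) → tournamentSum k P ≡ tournamentSum k Q
  tournamentSum-cong k e = pointwise (linear-ΣDigraph k) (λ A → cong (λ b → [ isTournamentᵇ A ∧ b ]· _) (e A))

  tournamentSum-guard : ∀ k b (P Q : Digraph k → Bool) →
    tournamentSum k (λ A → (b ∧ P A) ∧ Q A) ≡ [ b ]· tournamentSum k (λ A → P A ∧ Q A)
  tournamentSum-guard k true  P Q = refl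
  tournamentSum-guard k false P Q =
    trans (pointwise (linear-ΣDigraph k) (λ A → cong (λ b → [ b ]· w ^ℚ descents A) (BP.∧-zeroʳ (isTournamentᵇ A))))
          (vanishes (linear-ΣDigraph k))

  tournamentSum-attach : ∀ k (P : Digraph (suc k) → Bool) →
    tournamentSum (suc k) P ≡ ΣVec k (λ c → w ^ℚ size c * tournamentSum k (λ A → P (attach c A)))
  tournamentSum-attach k P = begin
    tournamentSum (suc k) P
      ≡⟨ pointwise (linear-ΣDigraph (suc k)) (λ A → []·-∧ (isTournamentᵇ A) (P A) (w ^ℚ descents A)) ⟩
    ΣDigraph (suc k) (λ A → [ isTournamentᵇ A ]· [ P A ]· w ^ℚ descents A)
      ≡⟨ ΣDigraph-tournaments-attach k (λ A → [ P A ]· w ^ℚ descents A) ⟩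
    ΣVec k (λ c → ΣDigraph k (λ A → [ isTournamentᵇ A ]· [ P (attach c A) ]· w ^ℚ descents (attach c A)))
      ≡⟨ pointwise (linear-ΣVec k) (λ c → trans (pointwise (linear-ΣDigraph k) (weight c))
                                                 (homogeneous (linear-ΣDigraph k) (w ^ℚ size c) _)) ⟩
    ΣVec k (λ c → w ^ℚ size c * tournamentSum k (λ A → P (attach c A))) ∎
    where
    weight : ∀ c A → [ isTournamentᵇ A ]· [ P (attach c A) ]· w ^ℚ descents (attach c A)
                   ≡ w ^ℚ size c * [ isTournamentᵇ A ∧ P (attach c A) ]· w ^ℚ descents A
    weight c A = begin
      [ isTournamentᵇ A ]· [ P (attach c A) ]· w ^ℚ descents (attach c A)
        ≡⟨ sym ([]·-∧ (isTournamentᵇ A) (P (attach c A)) (w ^ℚ descents (attach c A))) ⟩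
      [ isTournamentᵇ A ∧ P (attach c A) ]· w ^ℚ descents (attach c A)
        ≡⟨ cong ([ isTournamentᵇ A ∧ P (attach c A) ]·_)
                (trans (cong (w ^ℚ_) (descents-extend false (V.map not c) c A)) (^ℚ-distribˡ-+-* w (size c) (descents A))) ⟩
      [ isTournamentᵇ A ∧ P (attach c A) ]· (w ^ℚ size c * w ^ℚ descents A)
        ≡⟨ []·-* (isTournamentᵇ A ∧ P (attach c A)) (w ^ℚ size c) (w ^ℚ descents A) ⟩
      w ^ℚ size c * [ isTournamentᵇ A ∧ P (attach c A) ]· w ^ℚ descents A ∎

  ΣVec-pow-size : ∀ m → ΣVec m (λ b → w ^ℚ size b) ≡ (1ℚ + w) ^ℚ m
  ΣVec-pow-size zero    = refl
  ΣVec-pow-size (suc m) = begin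
    ΣVec m (λ v → w * w ^ℚ size v) + ΣVec m (λ v → w ^ℚ size v)
      ≡⟨ cong (_+ ΣVec m (λ v → w ^ℚ size v)) (homogeneous (linear-ΣVec m) w (λ v → w ^ℚ size v)) ⟩
    w * ΣVec m (λ v → w ^ℚ size v) + ΣVec m (λ v → w ^ℚ size v)
      ≡⟨ cong (λ z → w * z + z) (ΣVec-pow-size m) ⟩
    w * (1ℚ + w) ^ℚ m + (1ℚ + w) ^ℚ m
      ≡⟨ solve 2 (λ w z → w :* z :+ z := (con 1ℚ :+ w) :* z) refl w ((1ℚ + w) ^ℚ m) ⟩
    (1ℚ + w) * (1ℚ + w) ^ℚ m ∎

  ΣVec-pow-size-merge-all : ∀ {n} (s : Vec Bool n) →
    ΣVec (cosize s) (λ b → w ^ℚ size (merge s (replicate (size s) true) b)) ≡ w ^ℚ size s * (1ℚ + w) ^ℚ cosize s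
  ΣVec-pow-size-merge-all s = begin
    ΣVec m (λ b → w ^ℚ size (merge s (replicate k true) b))
      ≡⟨ pointwise (linear-ΣVec m) (λ b → trans (cong (w ^ℚ_) (size-merge-all b)) (^ℚ-distribˡ-+-* w k (size b))) ⟩
    ΣVec m (λ b → w ^ℚ k * w ^ℚ size b)
      ≡⟨ homogeneous (linear-ΣVec m) (w ^ℚ k) (λ b → w ^ℚ size b) ⟩
    w ^ℚ k * ΣVec m (λ b → w ^ℚ size b)
      ≡⟨ cong (w ^ℚ k *_) (ΣVec-pow-size m) ⟩
    w ^ℚ k * (1ℚ + w) ^ℚ m ∎
    where
    k m : ℕ
    k = size s
    m = cosize s
    size-merge-all : ∀ b → size (merge s (replicate k true) b) ≡ k ℕ.+ size b
    size-merge-all b = trans (size-merge s _ b) (cong (ℕ._+ size b) (size-replicate-true k))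

  ClosedSumFormula : ∀ {n} → Vec Bool n → Set
  ClosedSumFormula {n} s = ∀ (P : Digraph (size s) → Bool) → Extensional P →
    tournamentSum n (λ D → closedᵇ s D ∧ P (restrict s D))
    ≡ (w ^ℚ inversions s * tournamentSum (size s) P) * (1ℚ + w) ^ℚ triangle (cosize s)

  closedSumFormula-[] : ClosedSumFormula []
  closedSumFormula-[] P ext = begin
    [ P (restrict [] emptyDigraph) ]· 1ℚ      ≡⟨ cong ([_]· 1ℚ) (ext _ _ (λ ())) ⟩
    [ P emptyDigraph ]· 1ℚ                     ≡⟨ solve 1 (λ x → x := (con 1ℚ :* x) :* con 1ℚ) refl _ ⟩
    (1ℚ * [ P emptyDigraph ]· 1ℚ) * 1ℚ         ∎

  closedSumFormula-∷true : ∀ {n} {s : Vec Bool n} → ClosedSumFormula s → ClosedSumFormula (true ∷ s)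
  closedSumFormula-∷true {n} {s} ih P ext = begin
    tournamentSum (suc n) (λ D → closedᵇ (true ∷ s) D ∧ P (restrict (true ∷ s) D))
      ≡⟨ tournamentSum-attach n (λ D → closedᵇ (true ∷ s) D ∧ P (restrict (true ∷ s) D)) ⟩
    ΣVec n (λ c → w ^ℚ size c * tournamentSum n (λ D → (outsideFree c ∧ closedᵇ s D) ∧ P′ c D))
      ≡⟨ pointwise (linear-ΣVec n) (λ c →
           trans (cong (w ^ℚ size c *_) (tournamentSum-guard n (outsideFree c) (closedᵇ s) (P′ c)))
                 (sym ([]·-* (outsideFree c) (w ^ℚ size c) (H c)))) ⟩
    ΣVec n (λ c → [ outsideFree c ]· G c)
      ≡⟨ ΣVec-merge s _ ⟩
    ΣVec k (λ a → ΣVec m (λ b → [ outsideFree (merge s a b) ]· G (merge s a b)))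
      ≡⟨ pointwise (linear-ΣVec k) (λ a →
           trans (pointwise (linear-ΣVec m) (λ b → cong ([_]· G (merge s a b)) (allFin-outside-merge s a b)))
                 (ΣVec-select-allFalse m (λ b → G (merge s a b)))) ⟩
    ΣVec k (λ a → G (merge s a (replicate m false)))
      ≡⟨ pointwise (linear-ΣVec k) G-merge ⟩
    ΣVec k (λ a → w ^ℚ size a * tournamentSum n (λ D → closedᵇ s D ∧ P (attach a (restrict s D))))
      ≡⟨ pointwise (linear-ΣVec k) (λ a → cong (w ^ℚ size a *_)
           (ih (λ A → P (attach a A)) (λ A A′ e → ext _ _ (extend-extensional false (V.map not a) a e)))) ⟩
    ΣVec k (λ a → w ^ℚ size a * ((I * tournamentSum k (λ A → P (attach a A))) * E))
      ≡⟨ pointwise (linear-ΣVec k) (λ a → solve 4 (λ x i t e → x :* ((i :* t) :* e) := (i :* (x :* t)) :* e)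
                                                    refl (w ^ℚ size a) I _ E) ⟩
    ΣVec k (λ a → (I * (w ^ℚ size a * tournamentSum k (λ A → P (attach a A)))) * E)
      ≡⟨ trans (homogeneousʳ (linear-ΣVec k) E _) (cong (_* E) (homogeneous (linear-ΣVec k) I _)) ⟩
    (I * ΣVec k (λ a → w ^ℚ size a * tournamentSum k (λ A → P (attach a A)))) * E
      ≡⟨ cong (λ z → (I * z) * E) (sym (tournamentSum-attach k P)) ⟩
    (I * tournamentSum (suc k) P) * E ∎
    where
    k m : ℕ
    k = size s
    m = cosize s
    I E : ℚ
    I = w ^ℚ inversions s
    E = (1ℚ + w) ^ℚ triangle m
    outsideFree : Vec Bool n → Bool
    outsideFree c = allFin n (λ i → lookup s i ∨ not (lookup c i))
    P′ : Vec Bool n → Digraph n → Bool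
    P′ c D = P (restrict (true ∷ s) (attach c D))
    H G : Vec Bool n → ℚ
    H c = tournamentSum n (λ D → closedᵇ s D ∧ P′ c D)
    G c = w ^ℚ size c * H c
    G-merge : ∀ a → G (merge s a (replicate m false))
                  ≡ w ^ℚ size a * tournamentSum n (λ D → closedᵇ s D ∧ P (attach a (restrict s D)))
    G-merge a = cong₂ (λ x y → w ^ℚ x * y)
      (trans (size-merge s a (replicate m false))
             (trans (cong (size a ℕ.+_) (size-replicate-false m)) (ℕP.+-identityʳ (size a))))
      (tournamentSum-cong n (λ D → cong (closedᵇ s D ∧_)
        (ext _ _ (restrict-attach-merge s a (replicate m false) D))))

  closedSumFormula-∷false : ∀ {n} {s : Vec Bool n} → ClosedSumFormula s → ClosedSumFormula (false ∷ s)
  closedSumFormula-∷false {n} {s} ih P ext = begin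
    tournamentSum (suc n) (λ D → closedᵇ (false ∷ s) D ∧ P (restrict s (tail D)))
      ≡⟨ tournamentSum-attach n (λ D → closedᵇ (false ∷ s) D ∧ P (restrict s (tail D))) ⟩
    ΣVec n (λ c → w ^ℚ size c * tournamentSum n (λ D → (insideFree c ∧ closedᵇ s D) ∧ P (restrict s D)))
      ≡⟨ pointwise (linear-ΣVec n) (λ c →
           trans (cong (w ^ℚ size c *_) (tournamentSum-guard n (insideFree c) (closedᵇ s) (λ D → P (restrict s D))))
                 (sym ([]·-* (insideFree c) (w ^ℚ size c) Γ))) ⟩
    ΣVec n (λ c → [ insideFree c ]· (w ^ℚ size c * Γ))
      ≡⟨ ΣVec-merge s _ ⟩
    ΣVec k (λ a → ΣVec m (λ b → [ insideFree (merge s a b) ]· (w ^ℚ size (merge s a b) * Γ)))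
      ≡⟨ pointwise (linear-ΣVec k) (λ a →
           trans (pointwise (linear-ΣVec m) (λ b → cong ([_]· (w ^ℚ size (merge s a b) * Γ))
                                                          (allFin-inside-complement-merge s a b)))
                 (pull-[]· (linear-ΣVec m) (allTrue a) (λ b → w ^ℚ size (merge s a b) * Γ))) ⟩
    ΣVec k (λ a → [ allTrue a ]· ΣVec m (λ b → w ^ℚ size (merge s a b) * Γ))
      ≡⟨ ΣVec-select-allTrue k _ ⟩
    ΣVec m (λ b → w ^ℚ size (merge s (replicate k true) b) * Γ)
      ≡⟨ homogeneousʳ (linear-ΣVec m) Γ (λ b → w ^ℚ size (merge s (replicate k true) b)) ⟩
    ΣVec m (λ b → w ^ℚ size (merge s (replicate k true) b)) * Γ
      ≡⟨ cong₂ _*_ (ΣVec-pow-size-merge-all s) (ih P ext) ⟩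
    (w ^ℚ k * (1ℚ + w) ^ℚ m) * ((w ^ℚ inversions s * T) * (1ℚ + w) ^ℚ triangle m)
      ≡⟨ solve 5 (λ a d b t c → (a :* d) :* ((b :* t) :* c) := ((a :* b) :* t) :* (d :* c)) refl
               (w ^ℚ k) ((1ℚ + w) ^ℚ m) (w ^ℚ inversions s) T ((1ℚ + w) ^ℚ triangle m) ⟩
    ((w ^ℚ k * w ^ℚ inversions s) * T) * ((1ℚ + w) ^ℚ m * (1ℚ + w) ^ℚ triangle m)
      ≡⟨ sym (cong₂ (λ x y → (x * T) * y) (^ℚ-distribˡ-+-* w k (inversions s))
                                          (^ℚ-distribˡ-+-* (1ℚ + w) m (triangle m))) ⟩
    (w ^ℚ (k ℕ.+ inversions s) * T) * (1ℚ + w) ^ℚ (m ℕ.+ triangle m) ∎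
    where
    k m : ℕ
    k = size s
    m = cosize s
    insideFree : Vec Bool n → Bool
    insideFree c = allFin n (λ j → not (lookup s j) ∨ not (lookup (V.map not c) j))
    Γ T : ℚ
    Γ = tournamentSum n (λ D → closedᵇ s D ∧ P (restrict s D))
    T = tournamentSum k P

  closedSumFormula : ∀ {n} (s : Vec Bool n) → ClosedSumFormula s
  closedSumFormula []          = closedSumFormula-[]
  closedSumFormula (true  ∷ s) = closedSumFormula-∷true {s = s} (closedSumFormula s)
  closedSumFormula (false ∷ s) = closedSumFormula-∷false {s = s} (closedSumFormula s)

  tournamentSum-all : ∀ n → tournamentSum n (λ _ → true) ≡ (1ℚ + w) ^ℚ triangle n
  tournamentSum-all n = begin
    tournamentSum n (λ _ → true)
      ≡⟨ tournamentSum-cong n (λ D → sym (trans (BP.∧-identityʳ _) (closedᵇ-replicate-false n D))) ⟩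
    tournamentSum n (λ D → closedᵇ none D ∧ true)
      ≡⟨ closedSumFormula none (λ _ → true) (λ _ _ _ → refl) ⟩
    (w ^ℚ inversions none * tournamentSum (size none) (λ _ → true)) * (1ℚ + w) ^ℚ triangle (cosize none)
      ≡⟨ cong₂ (λ i k → (w ^ℚ i * tournamentSum k (λ _ → true)) * (1ℚ + w) ^ℚ triangle (cosize none))
               (inversions-replicate-false n) (size-replicate-false n) ⟩
    (1ℚ * 1ℚ) * (1ℚ + w) ^ℚ triangle (cosize none)
      ≡⟨ cong (λ m → (1ℚ * 1ℚ) * (1ℚ + w) ^ℚ triangle m) (cosize-replicate-false n) ⟩
    (1ℚ * 1ℚ) * (1ℚ + w) ^ℚ triangle n
      ≡⟨ ℚP.*-identityˡ _ ⟩
    (1ℚ + w) ^ℚ triangle n ∎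
    where
    none : Vec Bool n
    none = replicate n false


-- The source component of a tournament

Closed : ∀ {n} → Vec Bool n → Digraph n → Set
Closed s D = ∀ x y → lookup s x ≡ false → lookup s y ≡ true → D x y ≡ false

closedᵇ⇒Closed : ∀ {n} (s : Vec Bool n) D → closedᵇ s D ≡ true → Closed s D
closedᵇ⇒Closed (true  ∷ s) D p zero    y       () sy
closedᵇ⇒Closed (true  ∷ s) D p (suc x) zero    sx sy = not-true⇒false
  (subst (λ z → z ∨ not (D (suc x) zero) ≡ true) sx (allFin-sound _ _ (BP.∧-conicalˡ _ _ p) x))
closedᵇ⇒Closed (true  ∷ s) D p (suc x) (suc y) sx sy =
  closedᵇ⇒Closed s (tail D) (BP.∧-conicalʳ _ _ p) x y sx sy
closedᵇ⇒Closed (false ∷ s) D p zero    zero    sx ()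
closedᵇ⇒Closed (false ∷ s) D p zero    (suc y) sx sy = not-true⇒false
  (subst (λ z → not z ∨ not (D zero (suc y)) ≡ true) sy (allFin-sound _ _ (BP.∧-conicalˡ _ _ p) y))
closedᵇ⇒Closed (false ∷ s) D p (suc x) zero    sx ()
closedᵇ⇒Closed (false ∷ s) D p (suc x) (suc y) sx sy =
  closedᵇ⇒Closed s (tail D) (BP.∧-conicalʳ _ _ p) x y sx sy

Closed⇒closedᵇ : ∀ {n} (s : Vec Bool n) D → Closed s D → closedᵇ s D ≡ true
Closed⇒closedᵇ []          D h = refl
Closed⇒closedᵇ (true  ∷ s) D h =
  cong₂ _∧_ (allFin-complete _ _ noEdgeIn) (Closed⇒closedᵇ s (tail D) (λ x y → h (suc x) (suc y)))
  where
  noEdgeIn : ∀ i → lookup s i ∨ not (D (suc i) zero) ≡ true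
  noEdgeIn i with lookup s i in si
  ... | true  = refl
  ... | false = cong not (h (suc i) zero si refl)
Closed⇒closedᵇ (false ∷ s) D h =
  cong₂ _∧_ (allFin-complete _ _ noEdgeOut) (Closed⇒closedᵇ s (tail D) (λ x y → h (suc x) (suc y)))
  where
  noEdgeOut : ∀ j → not (lookup s j) ∨ not (D zero (suc j)) ≡ true
  noEdgeOut j with lookup s j in sj
  ... | false = refl
  ... | true  = cong not (h zero (suc j) refl sj)

Member : ∀ {n} → Vec Bool n → Set
Member {n} s = Σ (Fin n) (λ x → lookup s x ≡ true)

lookup-embed : ∀ {n} (s : Vec Bool n) i → lookup s (embed s i) ≡ true
lookup-embed (true  ∷ s) zero    = refl
lookup-embed (true  ∷ s) (suc i) = lookup-embed s i
lookup-embed (false ∷ s) i       = lookup-embed s i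

embed-preimage : ∀ {n} (s : Vec Bool n) x → lookup s x ≡ true → Σ (Fin (size s)) (λ i → embed s i ≡ x)
embed-preimage (true  ∷ s) zero    p = zero , refl
embed-preimage (true  ∷ s) (suc x) p = let (i , e) = embed-preimage s x p in suc i , cong suc e
embed-preimage (false ∷ s) (suc x) p = let (i , e) = embed-preimage s x p in i , cong suc e

embed-injective : ∀ {n} (s : Vec Bool n) {i j} → embed s i ≡ embed s j → i ≡ j
embed-injective (true  ∷ s) {zero}  {zero}  e = refl
embed-injective (true  ∷ s) {suc i} {suc j} e = cong suc (embed-injective s (FP.suc-injective e))
embed-injective (false ∷ s)                 e = embed-injective s (FP.suc-injective e)

Member⇒size≢0 : ∀ {n} (s : Vec Bool n) → Member s → size s ≢ 0
Member⇒size≢0 (true  ∷ s) (zero  , p) ()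
Member⇒size≢0 (true  ∷ s) (suc x , p) ()
Member⇒size≢0 (false ∷ s) (suc x , p) = Member⇒size≢0 s (x , p)

size≢0⇒Member : ∀ {n} (s : Vec Bool n) → size s ≢ 0 → Member s
size≢0⇒Member []          h = ⊥-elim (h refl)
size≢0⇒Member (true  ∷ s) h = zero , refl
size≢0⇒Member (false ∷ s) h = let (x , p) = size≢0⇒Member s h in suc x , p

_⊆_ : ∀ {n} → Vec Bool n → Vec Bool n → Set
t ⊆ s = ∀ x → lookup t x ≡ true → lookup s x ≡ true

size-mono-⊆ : ∀ {n} (t s : Vec Bool n) → t ⊆ s → size t ≤ size s
size-mono-⊆ []          []          h = z≤n
size-mono-⊆ (true  ∷ t) (true  ∷ s) h = s≤s (size-mono-⊆ t s (λ x → h (suc x)))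
size-mono-⊆ (false ∷ t) (true  ∷ s) h = ℕP.m≤n⇒m≤1+n (size-mono-⊆ t s (λ x → h (suc x)))
size-mono-⊆ (false ∷ t) (false ∷ s) h = size-mono-⊆ t s (λ x → h (suc x))
size-mono-⊆ (true  ∷ t) (false ∷ s) h with h zero refl
... | ()

size-strictMono-⊆ : ∀ {n} (t s : Vec Bool n) → t ⊆ s → ∀ a → lookup s a ≡ true → lookup t a ≡ false → size t < size s
size-strictMono-⊆ (true  ∷ t) (true  ∷ s) h zero    p ()
size-strictMono-⊆ (false ∷ t) (true  ∷ s) h zero    p q = s≤s (size-mono-⊆ t s (λ x → h (suc x)))
size-strictMono-⊆ (true  ∷ t) (true  ∷ s) h (suc a) p q = s≤s (size-strictMono-⊆ t s (λ x → h (suc x)) a p q)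
size-strictMono-⊆ (false ∷ t) (true  ∷ s) h (suc a) p q =
  ℕP.m<n⇒m<1+n (size-strictMono-⊆ t s (λ x → h (suc x)) a p q)
size-strictMono-⊆ (false ∷ t) (false ∷ s) h (suc a) p q = size-strictMono-⊆ t s (λ x → h (suc x)) a p q
size-strictMono-⊆ (true  ∷ t) (false ∷ s) h a       p q with h zero refl
... | ()

record IsSourceComponent {n} (S : Vec Bool n) (D : Digraph n) : Set where
  field
    member : Member S
    closed : Closed S D
    strong : StronglyConnected (restrict S D)

no-path-into-Closed : ∀ {n} (S : Vec Bool n) {D : Digraph n} → Closed S D →
  ∀ {x b} → Star (Edge D) x b → lookup S x ≡ false → lookup S b ≡ true → ⊥
no-path-into-Closed S cl ε sx sb = true≢false (trans (sym sb) sx)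
no-path-into-Closed S cl {x} (_◅_ {j = x′} e rest) sx sb with lookup S x′ in sx′
... | true  = true≢false (trans (sym e) (cl x x′ sx sx′))
... | false = no-path-into-Closed S cl rest sx′ sb

sourceComponent-path : ∀ {n} {S : Vec Bool n} {D : Digraph n} → IsSourceComponent S D →
  ∀ {x b} → lookup S x ≡ true → lookup S b ≡ true → Star (Edge D) x b
sourceComponent-path {S = S} c {x} {b} Sx Sb with embed-preimage S x Sx | embed-preimage S b Sb
... | i , refl | j , refl = gmap (embed S) (λ e → e) (IsSourceComponent.strong c i j)

sourceComponent-unique : ∀ {n} (D : Digraph n) → IsTournament D → ∀ {S S′} →
  IsSourceComponent S D → IsSourceComponent S′ D → S ≡ S′
sourceComponent-unique {n} D (_ , antisym) {S} {S′} c c′ =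
  trans (sym (VP.tabulate∘lookup S)) (trans (VP.tabulate-cong agree) (VP.tabulate∘lookup S′))
  where
  open IsSourceComponent
  -- For x ∈ S ∖ S′ and b ∈ S′: if b ∈ S, the strong component S yields a path from x into the
  -- closed set S′; otherwise the tournament edge between x and b enters S or S′.
  only-in-first⇒⊥ : ∀ {S S′} → IsSourceComponent S D → IsSourceComponent S′ D →
         ∀ x → lookup S x ≡ true → lookup S′ x ≡ false → ⊥
  only-in-first⇒⊥ {S} {S′} c c′ x Sx S′x with member c′
  ... | b , S′b with lookup S b in Sb
  ...   | true  = no-path-into-Closed S′ (closed c′) (sourceComponent-path c Sx Sb) S′x S′b
  ...   | false = true≢false (sym (trans (sym (closed c′ x b S′x S′b))
                    (trans (antisym x b x≢b) (cong not (closed c b x Sb Sx)))))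
    where
    x≢b : x ≢ b
    x≢b x≡b = true≢false (trans (sym Sx) (trans (cong (lookup S) x≡b) Sb))
  agree : ∀ x → lookup S x ≡ lookup S′ x
  agree x with lookup S x in Sx | lookup S′ x in S′x
  ... | true  | true  = refl
  ... | false | false = refl
  ... | true  | false = ⊥-elim (only-in-first⇒⊥ c c′ x Sx S′x)
  ... | false | true  = ⊥-elim (only-in-first⇒⊥ c′ c x S′x Sx)

module _ (sc? : ∀ {n} (D : Digraph n) → Dec (StronglyConnected D)) where

  -- Adding all edges out of b and all edges into a makes G strongly connected exactly
  -- when a reaches b in G, so sc? decides reachability.
  shortcut : ∀ {n} → Digraph n → Fin n → Fin n → Digraph n
  shortcut G a b x y = G x y ∨ (does (x F.≟ b) ∨ does (y F.≟ a))

  shortcut-path⇒path : ∀ {n} (G : Digraph n) a b x →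
    Star (Edge G) a x → Star (Edge (shortcut G a b)) x b → Star (Edge G) a b
  shortcut-path⇒path G a b x p ε = p
  shortcut-path⇒path G a b x p (_◅_ {j = x′} e rest) with G x x′ in Gxx′
  ... | true = shortcut-path⇒path G a b x′ (p ◅◅ (Gxx′ ◅ ε)) rest
  ... | false with x F.≟ b
  ...   | yes refl = p
  ...   | no _ with x′ F.≟ a
  ...     | yes refl = shortcut-path⇒path G a b a ε rest
  ...     | no _     = ⊥-elim (true≢false (sym e))

  path⇒shortcut-strong : ∀ {n} (G : Digraph n) a b → Star (Edge G) a b → StronglyConnected (shortcut G a b)
  path⇒shortcut-strong G a b p x y =
    ∨-introʳ (G x a) (∨-introʳ (does (x F.≟ b)) (dec-true (a F.≟ a) refl))
    ◅ (gmap (λ z → z) (λ {i} {j} e → ∨-introˡ _ e) p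
    ◅◅ (∨-introʳ (G b y) (∨-introˡ _ (dec-true (b F.≟ b) refl)) ◅ ε))

  reachable? : ∀ {n} (G : Digraph n) a b → Dec (Star (Edge G) a b)
  reachable? G a b with sc? (shortcut G a b)
  ... | yes p = yes (shortcut-path⇒path G a b a ε (p a b))
  ... | no ¬p = no (λ q → ¬p (path⇒shortcut-strong G a b q))

  strong-extensional : ∀ {k} → Extensional (λ (A : Digraph k) → does (sc? A))
  strong-extensional A A′ e with sc? A | sc? A′
  ... | yes _ | yes _  = refl
  ... | no  _ | no  _  = refl
  ... | yes p | no ¬p′ = ⊥-elim (¬p′ (λ a b → gmap (λ z → z) (λ {i} {j} Aij → trans (sym (e i j)) Aij) (p a b)))
  ... | no ¬p | yes p′ = ⊥-elim (¬p (λ a b → gmap (λ z → z) (λ {i} {j} A′ij → trans (e i j) A′ij) (p′ a b)))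

  module _ {n} (D : Digraph n) where

    inside : Vec Bool n → Digraph n
    inside S x y = lookup S x ∧ (lookup S y ∧ D x y)

    inside-path⇒restrict-path : ∀ S {x y} → Star (Edge (inside S)) x y →
      ∀ i → embed S i ≡ x → ∀ j → embed S j ≡ y → Star (Edge (restrict S D)) i j
    inside-path⇒restrict-path S ε i refl j ej = subst (Star (Edge (restrict S D)) i) (embed-injective S (sym ej)) ε
    inside-path⇒restrict-path S (_◅_ {j = x′} e rest) i refl j ej
      with embed-preimage S x′ (BP.∧-conicalˡ (lookup S x′) _ (BP.∧-conicalʳ (lookup S (embed S i)) _ e))
    ... | i′ , refl = BP.∧-conicalʳ (lookup S (embed S i′)) _ (BP.∧-conicalʳ (lookup S (embed S i)) _ e)
                      ◅ inside-path⇒restrict-path S rest i′ refl j ej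

    Linked : Vec Bool n → Fin n → Fin n → Set
    Linked S a b = lookup S a ≡ true → lookup S b ≡ true → Star (Edge (inside S)) a b

    linked? : ∀ S a b → Dec (Linked S a b)
    linked? S a b with lookup S a | lookup S b
    ... | false | _     = yes (λ ())
    ... | true  | false = yes (λ _ ())
    ... | true  | true  with reachable? (inside S) a b
    ...   | yes p = yes (λ _ _ → p)
    ...   | no ¬p = no (λ l → ¬p (l refl refl))

    unlinked : ∀ S a b → ¬ Linked S a b →
      (lookup S a ≡ true) × (lookup S b ≡ true) × ¬ Star (Edge (inside S)) a b
    unlinked S a b ¬l with lookup S a in Sa | lookup S b in Sb
    ... | true  | true  = refl , refl , (λ p → ¬l (λ _ _ → p))
    ... | false | _     = ⊥-elim (¬l (λ ()))
    ... | true  | false = ⊥-elim (¬l (λ _ ()))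

    unreachedFrom : Vec Bool n → Fin n → Vec Bool n
    unreachedFrom S a = V.tabulate (λ x → lookup S x ∧ not (does (reachable? (inside S) a x)))

    lookup-unreachedFrom : ∀ S a x → lookup (unreachedFrom S a) x ≡ lookup S x ∧ not (does (reachable? (inside S) a x))
    lookup-unreachedFrom S a x = VP.lookup∘tabulate _ x

    unreachedFrom-⊆ : ∀ S a → unreachedFrom S a ⊆ S
    unreachedFrom-⊆ S a x p = BP.∧-conicalˡ (lookup S x) _ (trans (sym (lookup-unreachedFrom S a x)) p)

    unreachedFrom-∉ : ∀ S a y → lookup (unreachedFrom S a) y ≡ true → ¬ Star (Edge (inside S)) a y
    unreachedFrom-∉ S a y Ty a⇝y = true≢false (trans (sym (dec-true (reachable? (inside S) a y) a⇝y))
      (not-true⇒false (BP.∧-conicalʳ (lookup S y) _ (trans (sym (lookup-unreachedFrom S a y)) Ty))))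

    unreachedFrom-∈ : ∀ S a x → lookup S x ≡ true → ¬ Star (Edge (inside S)) a x → lookup (unreachedFrom S a) x ≡ true
    unreachedFrom-∈ S a x Sx a↛x = trans (lookup-unreachedFrom S a x)
      (cong₂ (λ u z → u ∧ not z) Sx (dec-false (reachable? (inside S) a x) a↛x))

    unreachedFrom-closed : ∀ S a → Closed S D → Closed (unreachedFrom S a) D
    unreachedFrom-closed S a cl x y Tx Ty with D x y in Dxy | lookup S x in Sx
    ... | false | _     = refl
    ... | true  | false = ⊥-elim (true≢false (trans (sym Dxy) (cl x y Sx (unreachedFrom-⊆ S a y Ty))))
    ... | true  | true  with reachable? (inside S) a x
    ...   | yes a⇝x = ⊥-elim (unreachedFrom-∉ S a y Ty (a⇝x ◅◅ (x→y ◅ ε)))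
      where
      x→y : inside S x y ≡ true
      x→y = subst₂ (λ u v → u ∧ (v ∧ D x y) ≡ true) (sym Sx) (sym (unreachedFrom-⊆ S a y Ty)) Dxy
    ...   | no  a↛x = ⊥-elim (true≢false (trans (sym (unreachedFrom-∈ S a x Sx a↛x)) Tx))

    -- If some a, b ∈ S are not linked inside S, the vertices of S that a does not reach
    -- still form a closed set, which contains b but not a.
    sourceComponent-within : ∀ fuel (S : Vec Bool n) → size S ≤ fuel → Closed S D → Member S →
                             Σ (Vec Bool n) (λ S₀ → IsSourceComponent S₀ D)
    sourceComponent-within zero S le cl m = ⊥-elim (Member⇒size≢0 S m (ℕP.n≤0⇒n≡0 le))
    sourceComponent-within (suc fuel) S le cl m with FP.all? (λ a → FP.all? (linked? S a))
    ... | yes linked = S , record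
      { member = m
      ; closed = cl
      ; strong = λ i j → inside-path⇒restrict-path S
                   (linked (embed S i) (embed S j) (lookup-embed S i) (lookup-embed S j)) i refl j refl
      }
    ... | no ¬linked =
      sourceComponent-within fuel T (ℕP.≤-pred (ℕP.≤-trans T<S le)) (unreachedFrom-closed S a cl) (b , Tb)
      where
      unlinkedPair : Σ (Fin n) (λ a → Σ (Fin n) (λ b → ¬ Linked S a b))
      unlinkedPair =
        let (a , ¬linked-a) = FP.¬∀⟶∃¬ n _ (λ a → FP.all? (linked? S a)) ¬linked
            (b , ¬linked-ab) = FP.¬∀⟶∃¬ n _ (linked? S a) ¬linked-a
        in a , b , ¬linked-ab
      a b : Fin n
      a = proj₁ unlinkedPair
      b = proj₁ (proj₂ unlinkedPair)
      a↛b : (lookup S a ≡ true) × (lookup S b ≡ true) × ¬ Star (Edge (inside S)) a b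
      a↛b = unlinked S a b (proj₂ (proj₂ unlinkedPair))
      T : Vec Bool n
      T = unreachedFrom S a
      Ta : lookup T a ≡ false
      Ta = BP.¬-not (λ Ta≡true → unreachedFrom-∉ S a a Ta≡true ε)
      Tb : lookup T b ≡ true
      Tb = unreachedFrom-∈ S a b (proj₁ (proj₂ a↛b)) (proj₂ (proj₂ a↛b))
      T<S : size T < size S
      T<S = size-strictMono-⊆ T S (unreachedFrom-⊆ S a) a (proj₁ a↛b) Ta

  sourceComponent-exists : ∀ {n} (D : Digraph (suc n)) → Σ (Vec Bool (suc n)) (λ S → IsSourceComponent S D)
  sourceComponent-exists {n} D =
    sourceComponent-within D (suc n) all (ℕP.≤-reflexive (size-replicate-true (suc n))) allClosed (zero , refl)
    where
    all : Vec Bool (suc n)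
    all = replicate (suc n) true
    allClosed : Closed all D
    allClosed x y ax _ = ⊥-elim (true≢false (trans (sym (VP.lookup-replicate x true)) ax))

  isSourceComponentᵇ : ∀ {n} → Digraph n → Vec Bool n → Bool
  isSourceComponentᵇ D S = (0 <ᵇ size S) ∧ (closedᵇ S D ∧ does (sc? (restrict S D)))

  isSourceComponentᵇ-sound : ∀ {n} D (S : Vec Bool n) → isSourceComponentᵇ D S ≡ true → IsSourceComponent S D
  isSourceComponentᵇ-sound D S p = record
    { member = size≢0⇒Member S (λ e → true≢false (trans (sym (BP.∧-conicalˡ _ _ p)) (cong (0 <ᵇ_) e)))
    ; closed = closedᵇ⇒Closed S D (BP.∧-conicalˡ _ _ rest)
    ; strong = dec-witness (sc? (restrict S D)) (BP.∧-conicalʳ _ _ rest)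
    }
    where
    rest : closedᵇ S D ∧ does (sc? (restrict S D)) ≡ true
    rest = BP.∧-conicalʳ (0 <ᵇ size S) _ p

  isSourceComponentᵇ-complete : ∀ {n} D (S : Vec Bool n) → IsSourceComponent S D → isSourceComponentᵇ D S ≡ true
  isSourceComponentᵇ-complete D S c =
    cong₂ _∧_ (0<ᵇsize (Member⇒size≢0 S member))
              (cong₂ _∧_ (Closed⇒closedᵇ S D closed) (dec-true (sc? (restrict S D)) strong))
    where
    open IsSourceComponent c
    0<ᵇsize : size S ≢ 0 → (0 <ᵇ size S) ≡ true
    0<ᵇsize h with size S
    ... | zero  = ⊥-elim (h refl)
    ... | suc _ = refl

  ΣVec-isSourceComponentᵇ : ∀ {n} (D : Digraph (suc n)) → IsTournament D →
    ΣVec (suc n) (λ S → [ isSourceComponentᵇ D S ]· 1ℚ) ≡ 1ℚ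
  ΣVec-isSourceComponentᵇ {n} D tournament =
    trans (ΣVec-unique (suc n) S₀ (λ S → [ isSourceComponentᵇ D S ]· 1ℚ) others)
          (cong ([_]· 1ℚ) (isSourceComponentᵇ-complete D S₀ c₀))
    where
    S₀ : Vec Bool (suc n)
    S₀ = proj₁ (sourceComponent-exists D)
    c₀ : IsSourceComponent S₀ D
    c₀ = proj₂ (sourceComponent-exists D)
    others : ∀ S → S ≢ S₀ → [ isSourceComponentᵇ D S ]· 1ℚ ≡ 0ℚ
    others S S≢S₀ with isSourceComponentᵇ D S in isC
    ... | false = refl
    ... | true  = ⊥-elim (S≢S₀ (sourceComponent-unique D tournament (isSourceComponentᵇ-sound D S isC) c₀))

-- Gaussian coefficients as inversion generating functions

size≤length : ∀ {n} (s : Vec Bool n) → size s ≤ n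
size≤length []          = z≤n
size≤length (true  ∷ s) = s≤s (size≤length s)
size≤length (false ∷ s) = ℕP.m≤n⇒m≤1+n (size≤length s)

cosize≡length∸size : ∀ {n} (s : Vec Bool n) → cosize s ≡ n ∸ size s
cosize≡length∸size []          = refl
cosize≡length∸size (true  ∷ s) = cosize≡length∸size s
cosize≡length∸size (false ∷ s) =
  trans (cong suc (cosize≡length∸size s)) (sym (ℕP.+-∸-assoc 1 (size≤length s)))

module _ (w : ℚ) where

  gaussian : ℕ → ℕ → ℚ
  gaussian n k = ΣVec n (λ S → [ does (size S ℕP.≟ k) ]· w ^ℚ inversions S)

  ΣVec-by-size : ∀ n (h : ℕ → ℚ) →
    ΣVec n (λ S → h (size S) * w ^ℚ inversions S) ≡ Σ[ upTo (suc n) ] (λ k → h k * gaussian n k)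
  ΣVec-by-size n h = begin
    ΣVec n (λ S → h (size S) * w ^ℚ inversions S)
      ≡⟨ pointwise (linear-ΣVec n) (λ S → sym (Σ[]-upTo-delta (suc n) (size S) (λ k → h k * w ^ℚ inversions S)
                                                                   (s≤s (size≤length S)))) ⟩
    ΣVec n (λ S → Σ[ upTo (suc n) ] (λ k → [ does (size S ℕP.≟ k) ]· (h k * w ^ℚ inversions S)))
      ≡⟨ interchanges-ΣVec n (linear-ΣL (upTo (suc n))) _ ⟩
    Σ[ upTo (suc n) ] (λ k → ΣVec n (λ S → [ does (size S ℕP.≟ k) ]· (h k * w ^ℚ inversions S)))
      ≡⟨ pointwise (linear-ΣL (upTo (suc n))) (λ k →
           trans (pointwise (linear-ΣVec n) (λ S → []·-* (does (size S ℕP.≟ k)) (h k) _))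
                 (homogeneous (linear-ΣVec n) (h k) _)) ⟩
    Σ[ upTo (suc n) ] (λ k → h k * gaussian n k) ∎
    where open ≡-Reasoning

  gaussian-zero : ∀ n → gaussian n 0 ≡ 1ℚ
  gaussian-zero zero    = refl
  gaussian-zero (suc n) = trans (+-identityˡ-when-zero _ (vanishes (linear-ΣVec n)))
                                (trans (pointwise (linear-ΣVec n) noInversions) (gaussian-zero n))
    where
    noInversions : ∀ v → [ does (size v ℕP.≟ 0) ]· w ^ℚ (size v ℕ.+ inversions v)
                       ≡ [ does (size v ℕP.≟ 0) ]· w ^ℚ inversions v
    noInversions v with size v
    ... | zero  = refl
    ... | suc _ = refl

  gaussian-> : ∀ n k → n < k → gaussian n k ≡ 0ℚ
  gaussian-> n k n<k = trans (pointwise (linear-ΣVec n) (λ S → cong ([_]· w ^ℚ inversions S)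
      (dec-false (size S ℕP.≟ k) (λ size≡k → ℕP.<-irrefl size≡k (ℕP.≤-<-trans (size≤length S) n<k)))))
    (vanishes (linear-ΣVec n))

  gaussian-suc : ∀ n k → gaussian (suc n) (suc k) ≡ gaussian n k + w ^ℚ suc k * gaussian n (suc k)
  gaussian-suc n k = cong (gaussian n k +_)
    (trans (pointwise (linear-ΣVec n) weight) (homogeneous (linear-ΣVec n) (w ^ℚ suc k) _))
    where
    weight : ∀ v → [ does (size v ℕP.≟ suc k) ]· w ^ℚ (size v ℕ.+ inversions v)
                 ≡ w ^ℚ suc k * [ does (size v ℕP.≟ suc k) ]· w ^ℚ inversions v
    weight v = trans ([]·-congʳ (does (size v ℕP.≟ suc k)) (λ size≡ →
                       trans (cong (λ z → w ^ℚ (z ℕ.+ inversions v)) (dec-witness (size v ℕP.≟ suc k) size≡))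
                             (^ℚ-distribˡ-+-* w (suc k) (inversions v))))
                     ([]·-* (does (size v ℕP.≟ suc k)) (w ^ℚ suc k) (w ^ℚ inversions v))

  gaussian-diagonal : ∀ n → gaussian n n ≡ 1ℚ
  gaussian-diagonal zero    = refl
  gaussian-diagonal (suc n) = begin
    gaussian (suc n) (suc n)                          ≡⟨ gaussian-suc n n ⟩
    gaussian n n + w ^ℚ suc n * gaussian n (suc n)
      ≡⟨ cong₂ (λ a b → a + w ^ℚ suc n * b) (gaussian-diagonal n) (gaussian-> n (suc n) ℕP.≤-refl) ⟩
    1ℚ + w ^ℚ suc n * 0ℚ
      ≡⟨ solve 1 (λ p → con 1ℚ :+ p :* con 0ℚ := con 1ℚ) refl (w ^ℚ suc n) ⟩
    1ℚ ∎
    where open ≡-Reasoning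

-- Tournaments by their source component

module _ (w : ℚ) (sc? : ∀ {n} (D : Digraph n) → Dec (StronglyConnected D)) where
  open ≡-Reasoning

  strongTournamentSum : ℕ → ℚ
  strongTournamentSum k = tournamentSum w k (λ A → does (sc? A))

  -- the contribution of a source component with k vertices, up to its inversions
  componentWeight : ℕ → ℕ → ℚ
  componentWeight n k = [ 0 <ᵇ k ]· (strongTournamentSum k * (1ℚ + w) ^ℚ triangle (n ∸ k))

  tournament-as-Σ-sourceComponents : ∀ N (D : Digraph (suc N)) →
    [ isTournamentᵇ D ∧ true ]· w ^ℚ descents D
    ≡ ΣVec (suc N) (λ S → [ 0 <ᵇ size S ]· [ isTournamentᵇ D ∧ (closedᵇ S D ∧ does (sc? (restrict S D))) ]· w ^ℚ descents D)
  tournament-as-Σ-sourceComponents N D with isTournamentᵇ D in isT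
  ... | true = begin
    x
      ≡⟨ sym (ℚP.*-identityʳ x) ⟩
    x * 1ℚ
      ≡⟨ cong (x *_) (sym (ΣVec-isSourceComponentᵇ sc? D (isTournamentᵇ-sound D isT))) ⟩
    x * ΣVec (suc N) (λ S → [ isSourceComponentᵇ sc? D S ]· 1ℚ)
      ≡⟨ sym (homogeneous (linear-ΣVec (suc N)) x (λ S → [ isSourceComponentᵇ sc? D S ]· 1ℚ)) ⟩
    ΣVec (suc N) (λ S → x * [ isSourceComponentᵇ sc? D S ]· 1ℚ)
      ≡⟨ pointwise (linear-ΣVec (suc N)) (λ S → trans (*-[]·1 (isSourceComponentᵇ sc? D S) x) ([]·-∧ (0 <ᵇ size S) _ x)) ⟩
    ΣVec (suc N) (λ S → [ 0 <ᵇ size S ]· [ closedᵇ S D ∧ does (sc? (restrict S D)) ]· x) ∎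
    where
    x : ℚ
    x = w ^ℚ descents D
  ... | false = sym (trans (pointwise (linear-ΣVec (suc N)) (λ S → []·-0 (0 <ᵇ size S))) (vanishes (linear-ΣVec (suc N))))

  tournamentSum-by-sourceComponent : ∀ N →
    tournamentSum w (suc N) (λ _ → true) ≡ Σ[ upTo (suc (suc N)) ] (λ k → componentWeight (suc N) k * gaussian w (suc N) k)
  tournamentSum-by-sourceComponent N = begin
    tournamentSum w (suc N) (λ _ → true)
      ≡⟨ pointwise (linear-ΣDigraph (suc N)) (tournament-as-Σ-sourceComponents N) ⟩
    ΣDigraph (suc N) (λ D → ΣVec (suc N) (λ S → [ 0 <ᵇ size S ]· F S D))
      ≡⟨ interchanges-ΣDigraph (suc N) (linear-ΣVec (suc N)) (λ D S → [ 0 <ᵇ size S ]· F S D) ⟩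
    ΣVec (suc N) (λ S → ΣDigraph (suc N) (λ D → [ 0 <ᵇ size S ]· F S D))
      ≡⟨ pointwise (linear-ΣVec (suc N)) (λ S →
           trans (pull-[]· (linear-ΣDigraph (suc N)) (0 <ᵇ size S) (F S))
                 (cong ([ 0 <ᵇ size S ]·_) (closedSumFormula w S (λ A → does (sc? A)) (strong-extensional sc?)))) ⟩
    ΣVec (suc N) (λ S → [ 0 <ᵇ size S ]· ((w ^ℚ inversions S * strongTournamentSum (size S)) * (1ℚ + w) ^ℚ triangle (cosize S)))
      ≡⟨ pointwise (linear-ΣVec (suc N)) regroup ⟩
    ΣVec (suc N) (λ S → componentWeight (suc N) (size S) * w ^ℚ inversions S)
      ≡⟨ ΣVec-by-size w (suc N) (componentWeight (suc N)) ⟩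
    Σ[ upTo (suc (suc N)) ] (λ k → componentWeight (suc N) k * gaussian w (suc N) k) ∎
    where
    F : Vec Bool (suc N) → Digraph (suc N) → ℚ
    F S D = [ isTournamentᵇ D ∧ (closedᵇ S D ∧ does (sc? (restrict S D))) ]· w ^ℚ descents D
    regroup : ∀ S → [ 0 <ᵇ size S ]· ((w ^ℚ inversions S * strongTournamentSum (size S)) * (1ℚ + w) ^ℚ triangle (cosize S))
                  ≡ componentWeight (suc N) (size S) * w ^ℚ inversions S
    regroup S = begin
      [ 0 <ᵇ size S ]· ((I * T) * E)   ≡⟨ cong ([ 0 <ᵇ size S ]·_) (ℚP.*-assoc I T E) ⟩
      [ 0 <ᵇ size S ]· (I * (T * E))   ≡⟨ []·-* (0 <ᵇ size S) I (T * E) ⟩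
      I * [ 0 <ᵇ size S ]· (T * E)     ≡⟨ ℚP.*-comm I _ ⟩
      [ 0 <ᵇ size S ]· (T * E) * I
        ≡⟨ cong (λ m → [ 0 <ᵇ size S ]· (T * (1ℚ + w) ^ℚ triangle m) * I) (cosize≡length∸size S) ⟩
      componentWeight (suc N) (size S) * I ∎
      where
      I T E : ℚ
      I = w ^ℚ inversions S
      T = strongTournamentSum (size S)
      E = (1ℚ + w) ^ℚ triangle (cosize S)

  tournament-recurrence : ∀ m → (1ℚ + w) ^ℚ triangle (suc m)
    ≡ Σ[ [ 1 ⋯ suc m ∸ 1 ] ] (λ k → componentWeight (suc m) k * gaussian w (suc m) k) + strongTournamentSum (suc m)
  tournament-recurrence m = begin
    (1ℚ + w) ^ℚ triangle N
      ≡⟨ sym (tournamentSum-all w N) ⟩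
    tournamentSum w N (λ _ → true)
      ≡⟨ tournamentSum-by-sourceComponent m ⟩
    Σ[ upTo (suc N) ] g
      ≡⟨ Σ[]-upTo-suc N g ⟩
    Σ[ upTo N ] g + g N
      ≡⟨ cong₂ _+_ emptyComponent wholeComponent ⟩
    Σ[ [ 1 ⋯ suc m ∸ 1 ] ] g + strongTournamentSum N ∎
    where
    N : ℕ
    N = suc m
    g : ℕ → ℚ
    g k = componentWeight N k * gaussian w N k
    emptyComponent : Σ[ upTo N ] g ≡ Σ[ [ 1 ⋯ suc m ∸ 1 ] ] g
    emptyComponent = trans (+-identityˡ-when-zero _ (ℚP.*-zeroˡ (gaussian w N 0)))
                           (cong (λ l → Σ[ l ] g) (sym (LP.map-upTo (1 ℕ.+_) m)))
    wholeComponent : g N ≡ strongTournamentSum N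
    wholeComponent = begin
      (strongTournamentSum N * (1ℚ + w) ^ℚ triangle (N ∸ N)) * gaussian w N N
        ≡⟨ cong₂ (λ d c → (strongTournamentSum N * (1ℚ + w) ^ℚ triangle d) * c) (ℕP.n∸n≡0 m) (gaussian-diagonal w N) ⟩
      (strongTournamentSum N * 1ℚ) * 1ℚ
        ≡⟨ trans (ℚP.*-identityʳ _) (ℚP.*-identityʳ _) ⟩
      strongTournamentSum N ∎

countᵇ : ∀ {X : Set} → List X → (X → Bool) → ℕ
countᵇ []       f = 0
countᵇ (x ∷ xs) f = (if f x then 1 else 0) ℕ.+ countᵇ xs f

sumℕ : ∀ {X : Set} → List X → (X → ℕ) → ℕ
sumℕ []       g = 0
sumℕ (x ∷ xs) g = g x ℕ.+ sumℕ xs g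

sumFin : ∀ n → (Fin n → ℕ) → ℕ
sumFin zero    g = 0
sumFin (suc n) g = g zero ℕ.+ sumFin n (λ i → g (suc i))

length-filter-T? : ∀ {X : Set} (xs : List X) (f : X → Bool) → L.length (L.filter (λ x → B.T? (f x)) xs) ≡ countᵇ xs f
length-filter-T? []       f = refl
length-filter-T? (x ∷ xs) f with f x
... | true  = cong suc (length-filter-T? xs f)
... | false = length-filter-T? xs f

countᵇ-++ : ∀ {X : Set} (xs ys : List X) f → countᵇ (xs ++ ys) f ≡ countᵇ xs f ℕ.+ countᵇ ys f
countᵇ-++ []       ys f = refl
countᵇ-++ (x ∷ xs) ys f =
  trans (cong ((if f x then 1 else 0) ℕ.+_) (countᵇ-++ xs ys f)) (sym (ℕP.+-assoc (if f x then 1 else 0) _ _))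

countᵇ-map : ∀ {X Y : Set} (g : X → Y) xs f → countᵇ (L.map g xs) f ≡ countᵇ xs (λ x → f (g x))
countᵇ-map g []       f = refl
countᵇ-map g (x ∷ xs) f = cong ((if f (g x) then 1 else 0) ℕ.+_) (countᵇ-map g xs f)

countᵇ-cartesianProduct : ∀ {X Y : Set} (xs : List X) (ys : List Y) f →
  countᵇ (L.cartesianProduct xs ys) f ≡ sumℕ xs (λ x → countᵇ ys (λ y → f (x , y)))
countᵇ-cartesianProduct []       ys f = refl
countᵇ-cartesianProduct (x ∷ xs) ys f = trans (countᵇ-++ (L.map (x ,_) ys) _ f)
  (cong₂ ℕ._+_ (countᵇ-map (x ,_) ys f) (countᵇ-cartesianProduct xs ys f))

countᵇ-tabulate : ∀ {X : Set} n (g : Fin n → X) f → countᵇ (L.tabulate g) f ≡ countFin n (λ i → f (g i))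
countᵇ-tabulate zero    g f = refl
countᵇ-tabulate (suc n) g f = cong ((if f (g zero) then 1 else 0) ℕ.+_) (countᵇ-tabulate n (λ i → g (suc i)) f)

sumℕ-tabulate : ∀ {X : Set} n (g : Fin n → X) h → sumℕ (L.tabulate g) h ≡ sumFin n (λ i → h (g i))
sumℕ-tabulate zero    g h = refl
sumℕ-tabulate (suc n) g h = cong (h (g zero) ℕ.+_) (sumℕ-tabulate n (λ i → g (suc i)) h)

sumℕ-cong : ∀ {X : Set} (xs : List X) {g h : X → ℕ} → (∀ x → g x ≡ h x) → sumℕ xs g ≡ sumℕ xs h
sumℕ-cong []       e = refl
sumℕ-cong (x ∷ xs) e = cong₂ ℕ._+_ (e x) (sumℕ-cong xs e)

sumFin-+ : ∀ n (g h : Fin n → ℕ) → sumFin n (λ i → g i ℕ.+ h i) ≡ sumFin n g ℕ.+ sumFin n h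
sumFin-+ zero    g h = refl
sumFin-+ (suc n) g h = trans (cong (g zero ℕ.+ h zero ℕ.+_) (sumFin-+ n _ _))
  (ℕ+-interchange (g zero) (h zero) (sumFin n (λ i → g (suc i))) (sumFin n (λ i → h (suc i))))

sumFin-indicator : ∀ n (f : Fin n → Bool) → sumFin n (λ i → if f i then 1 else 0) ≡ countFin n f
sumFin-indicator zero    f = refl
sumFin-indicator (suc n) f = cong ((if f zero then 1 else 0) ℕ.+_) (sumFin-indicator n (λ i → f (suc i)))

countFin-false : ∀ n → countFin n (λ _ → false) ≡ 0
countFin-false zero    = refl
countFin-false (suc n) = countFin-false n

descent? : ∀ {n} → Digraph n → Fin n → Fin n → Bool
descent? D s t = (toℕ t <ᵇ toℕ s) ∧ D s t

sumFin-descents : ∀ {n} (D : Digraph n) → sumFin n (λ s → countFin n (descent? D s)) ≡ descents D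
sumFin-descents {zero}  D = refl
sumFin-descents {suc n} D = cong₂ ℕ._+_ (countFin-false (suc n))
  (trans (sumFin-+ n (λ s → if D (suc s) zero then 1 else 0) (λ s → countFin n (descent? (tail D) s)))
         (cong₂ ℕ._+_ (sumFin-indicator n (λ s → D (suc s) zero)) (sumFin-descents (tail D))))

des≡descents : ∀ {n} (D : Digraph n) → des D ≡ descents D
des≡descents {n} D = begin
  des D
    ≡⟨ length-filter-T? (L.cartesianProduct (L.allFin n) (L.allFin n)) (λ p → descent? D (proj₁ p) (proj₂ p)) ⟩
  countᵇ (L.cartesianProduct (L.allFin n) (L.allFin n)) (λ p → descent? D (proj₁ p) (proj₂ p))
    ≡⟨ countᵇ-cartesianProduct (L.allFin n) (L.allFin n) _ ⟩
  sumℕ (L.allFin n) (λ s → countᵇ (L.allFin n) (descent? D s))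
    ≡⟨ sumℕ-cong (L.allFin n) (λ s → countᵇ-tabulate n (λ i → i) (descent? D s)) ⟩
  sumℕ (L.allFin n) (λ s → countFin n (descent? D s))
    ≡⟨ sumℕ-tabulate n (λ i → i) (λ s → countFin n (descent? D s)) ⟩
  sumFin n (λ s → countFin n (descent? D s))
    ≡⟨ sumFin-descents D ⟩
  descents D ∎
  where open ≡-Reasoning

ΣL-filter : ∀ {X : Set} {P : X → Set} (P? : ∀ x → Dec (P x)) (xs : List X) f →
  ΣL (L.filter P? xs) f ≡ ΣL xs (λ x → [ does (P? x) ]· f x)
ΣL-filter P? []       f = refl
ΣL-filter P? (x ∷ xs) f with does (P? x)
... | true  = cong (f x +_) (ΣL-filter P? xs f)
... | false = trans (ΣL-filter P? xs f) (sym (ℚP.+-identityˡ _))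

ΣL-concatMap : ∀ {X Y : Set} (h : X → List Y) xs f → ΣL (L.concatMap h xs) f ≡ ΣL xs (λ x → ΣL (h x) f)
ΣL-concatMap h []       f = refl
ΣL-concatMap h (x ∷ xs) f = trans (ΣL-++ (h x) (L.concatMap h xs) f) (cong (ΣL (h x) f +_) (ΣL-concatMap h xs f))

ΣL-allVecs : ∀ {X : Set} n (xs : List X) f → ΣL (allVecs n xs) f ≡ ΣPow (ΣL xs) n f
ΣL-allVecs zero    xs f = ℚP.+-identityʳ (f [])
ΣL-allVecs (suc n) xs f = trans (ΣL-concatMap (λ x → L.map (x ∷_) (allVecs n xs)) xs f)
  (pointwise (linear-ΣL xs) (λ x → trans (ΣL-map (x ∷_) (allVecs n xs) f) (ΣL-allVecs n xs (λ v → f (x ∷ v)))))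

ΣPow-cong : ∀ {X : Set} {S S′ : (X → ℚ) → ℚ} → Linear S → (∀ g → S g ≡ S′ g) →
            ∀ n f → ΣPow S n f ≡ ΣPow S′ n f
ΣPow-cong LS e zero    f = refl
ΣPow-cong LS e (suc n) f = trans (pointwise LS (λ x → ΣPow-cong LS e n (λ v → f (x ∷ v)))) (e _)

ΣL-allVecs-Bool : ∀ n f → ΣL (allVecs n (true ∷ false ∷ [])) f ≡ ΣVec n f
ΣL-allVecs-Bool n f = trans (ΣL-allVecs n (true ∷ false ∷ []) f)
  (ΣPow-cong (linear-ΣL (true ∷ false ∷ [])) (λ g → cong (g true +_) (ℚP.+-identityʳ (g false))) n f)

ΣPow-ΣVec-suc : ∀ n m H → ΣPow (ΣVec (suc m)) n H
  ≡ ΣVec n (λ c → ΣPow (ΣVec m) n (λ rows → H (V.zipWith _∷_ c rows)))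
ΣPow-ΣVec-suc zero    m H = refl
ΣPow-ΣVec-suc (suc n) m H = pointwise linear-ΣBool (λ x →
  trans (pointwise (linear-ΣVec m) (λ v → ΣPow-ΣVec-suc n m (λ rows → H ((x ∷ v) ∷ rows))))
        (interchanges-ΣVec m (linear-ΣVec n) (λ v c → ΣPow (ΣVec m) n (λ rows → H ((x ∷ v) ∷ V.zipWith _∷_ c rows)))))

toDigraph : ∀ {n} → Vec (Vec Bool n) n → Digraph n
toDigraph m i j = lookup (lookup m i) j

toDigraph-extend : ∀ {n} b (r c : Vec Bool n) rows → ∀ i j →
  toDigraph ((b ∷ r) ∷ V.zipWith _∷_ c rows) i j ≡ extend b r c (toDigraph rows) i j
toDigraph-extend b r c rows zero    zero    = refl
toDigraph-extend b r c rows zero    (suc j) = refl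
toDigraph-extend b r c rows (suc i) zero    = cong (λ v → lookup v zero) (VP.lookup-zipWith _∷_ i c rows)
toDigraph-extend b r c rows (suc i) (suc j) = cong (λ v → lookup v (suc j)) (VP.lookup-zipWith _∷_ i c rows)

ΣPow-ΣVec-ΣDigraph : ∀ n (F : Digraph n → ℚ) → Extensional F → ΣPow (ΣVec n) n (λ m → F (toDigraph m)) ≡ ΣDigraph n F
ΣPow-ΣVec-ΣDigraph zero    F ext = ext _ _ (λ ())
ΣPow-ΣVec-ΣDigraph (suc n) F ext = pointwise linear-ΣBool (λ b → pointwise (linear-ΣVec n) (λ r →
  trans (ΣPow-ΣVec-suc n n (λ rows → F (toDigraph ((b ∷ r) ∷ rows))))
        (pointwise (linear-ΣVec n) (λ c →
          trans (pointwise (linear-ΣPow (linear-ΣVec n) n) (λ rows → ext _ _ (toDigraph-extend b r c rows)))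
                (ΣPow-ΣVec-ΣDigraph n (λ D → F (extend b r c D))
                  (λ D D′ e → ext _ _ (extend-extensional b r c e)))))))

allFin-cong : ∀ n {f g : Fin n → Bool} → (∀ i → f i ≡ g i) → allFin n f ≡ allFin n g
allFin-cong zero    e = refl
allFin-cong (suc n) e = cong₂ _∧_ (e zero) (allFin-cong n (λ i → e (suc i)))

countFin-cong : ∀ n {f g : Fin n → Bool} → (∀ i → f i ≡ g i) → countFin n f ≡ countFin n g
countFin-cong zero    e = refl
countFin-cong (suc n) e = cong₂ (λ b k → (if b then 1 else 0) ℕ.+ k) (e zero) (countFin-cong n (λ i → e (suc i)))

isTournamentᵇ-extensional : ∀ {n} → Extensional (isTournamentᵇ {n})
isTournamentᵇ-extensional {zero}  D D′ e = refl
isTournamentᵇ-extensional {suc n} D D′ e = cong₂ _∧_ (cong not (e zero zero))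
  (cong₂ _∧_ (allFin-cong n (λ j → cong₂ _xor_ (e zero (suc j)) (e (suc j) zero)))
             (isTournamentᵇ-extensional (tail D) (tail D′) (λ i j → e (suc i) (suc j))))

descents-extensional : ∀ {n} → Extensional (descents {n})
descents-extensional {zero}  D D′ e = refl
descents-extensional {suc n} D D′ e = cong₂ ℕ._+_ (countFin-cong n (λ i → e (suc i) zero))
  (descents-extensional (tail D) (tail D′) (λ i j → e (suc i) (suc j)))

isTournament?≡isTournamentᵇ : ∀ {n} (D : Digraph n) → does (isTournament? D) ≡ isTournamentᵇ D
isTournament?≡isTournamentᵇ D with isTournamentᵇ D in isT
... | true  = dec-true (isTournament? D) (isTournamentᵇ-sound D isT)
... | false = dec-false (isTournament? D) (λ t → true≢false (trans (sym (isTournamentᵇ-complete D t)) isT))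

t≡strongTournamentSum : (sc? : ∀ {n} (D : Digraph n) → Dec (StronglyConnected D)) →
  ∀ n w → t sc? n w ≡ strongTournamentSum w sc? n
t≡strongTournamentSum sc? n w = begin
  t sc? n w
    ≡⟨ ΣL-filter (λ D → isTournament? D ×-dec sc? D) (allDigraphs n) (λ D → w ^ℚ des D) ⟩
  ΣL (allDigraphs n) (λ D → [ does (isTournament? D ×-dec sc? D) ]· w ^ℚ des D)
    ≡⟨ ΣL-map toDigraph matrices (λ D → [ does (isTournament? D ×-dec sc? D) ]· w ^ℚ des D) ⟩
  ΣL matrices (λ m → [ does (isTournament? (toDigraph m) ×-dec sc? (toDigraph m)) ]· w ^ℚ des (toDigraph m))
    ≡⟨ pointwise (linear-ΣL matrices) (λ m → cong₂ (λ b k → [ b ∧ does (sc? (toDigraph m)) ]· w ^ℚ k)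
         (isTournament?≡isTournamentᵇ (toDigraph m)) (des≡descents (toDigraph m))) ⟩
  ΣL matrices (λ m → F (toDigraph m))
    ≡⟨ ΣL-allVecs n (allVecs n (true ∷ false ∷ [])) (λ m → F (toDigraph m)) ⟩
  ΣPow (ΣL (allVecs n (true ∷ false ∷ []))) n (λ m → F (toDigraph m))
    ≡⟨ ΣPow-cong (linear-ΣL (allVecs n (true ∷ false ∷ []))) (ΣL-allVecs-Bool n) n (λ m → F (toDigraph m)) ⟩
  ΣPow (ΣVec n) n (λ m → F (toDigraph m))
    ≡⟨ ΣPow-ΣVec-ΣDigraph n F extensional ⟩
  strongTournamentSum w sc? n ∎
  where
  open ≡-Reasoning
  matrices : List (Vec (Vec Bool n) n)
  matrices = allVecs n (allVecs n (true ∷ false ∷ []))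
  F : Digraph n → ℚ
  F A = [ isTournamentᵇ A ∧ does (sc? A) ]· w ^ℚ descents A
  extensional : Extensional F
  extensional D D′ e = cong₂ (λ b k → [ b ]· w ^ℚ k)
    (cong₂ _∧_ (isTournamentᵇ-extensional D D′ e) (strong-extensional sc? D D′ e))
    (descents-extensional D D′ e)

-- Gaussian coefficients are q-binomial coefficients

div-inverseʳ : ∀ y → y ≢ 0ℚ → y * (1ℚ ÷' y) ≡ 1ℚ
div-inverseʳ y y≢0 with y ℚP.≟ 0ℚ
... | yes y≡0 = ⊥-elim (y≢0 y≡0)
... | no  y≢0′ = trans (cong (y *_) (ℚP.*-identityˡ _)) (ℚP.*-inverseʳ y {{ℚ.≢-nonZero y≢0′}})

div-unique : ∀ c d x → d ≢ 0ℚ → x * d ≡ c → c ÷' d ≡ x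
div-unique c d x d≢0 e with d ℚP.≟ 0ℚ
... | yes d≡0 = ⊥-elim (d≢0 d≡0)
... | no  d≢0′ = begin
  c * 1/ d            ≡⟨ cong (_* 1/ d) (sym e) ⟩
  (x * d) * 1/ d      ≡⟨ ℚP.*-assoc x d _ ⟩
  x * (d * 1/ d)      ≡⟨ cong (x *_) (ℚP.*-inverseʳ d) ⟩
  x * 1ℚ              ≡⟨ ℚP.*-identityʳ x ⟩
  x                   ∎
  where
  open ≡-Reasoning
  instance
    d-nonZero : ℚ.NonZero d
    d-nonZero = ℚ.≢-nonZero d≢0′

*-≢0 : ∀ a b → a ≢ 0ℚ → b ≢ 0ℚ → a * b ≢ 0ℚ
*-≢0 a b a≢0 b≢0 ab≡0 = b≢0 (begin
  b                      ≡⟨ sym (ℚP.*-identityˡ b) ⟩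
  1ℚ * b                 ≡⟨ cong (_* b) (sym (trans (ℚP.*-comm (1ℚ ÷' a) a) (div-inverseʳ a a≢0))) ⟩
  ((1ℚ ÷' a) * a) * b    ≡⟨ ℚP.*-assoc (1ℚ ÷' a) a b ⟩
  (1ℚ ÷' a) * (a * b)    ≡⟨ cong ((1ℚ ÷' a) *_) ab≡0 ⟩
  (1ℚ ÷' a) * 0ℚ         ≡⟨ ℚP.*-zeroʳ (1ℚ ÷' a) ⟩
  0ℚ                     ∎)
  where open ≡-Reasoning

qint-suc : ∀ q a → qint q (suc a) ≡ 1ℚ + q * qint q a
qint-suc q a = cong (1ℚ +_) (shift (λ i → i) a)
  where
  shift : ∀ (f : ℕ → ℕ) a → Σ[ applyUpTo (λ i → suc (f i)) a ] (λ i → q ^ℚ i) ≡ q * Σ[ applyUpTo f a ] (λ i → q ^ℚ i)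
  shift f zero    = sym (ℚP.*-zeroʳ q)
  shift f (suc a) = trans (cong ((q * q ^ℚ f 0) +_) (shift (λ i → f (suc i)) a)) (sym (ℚP.*-distribˡ-+ q _ _))

qint-+ : ∀ q a b → qint q (a ℕ.+ b) ≡ qint q a + q ^ℚ a * qint q b
qint-+ q zero    b = sym (trans (ℚP.+-identityˡ _) (ℚP.*-identityˡ _))
qint-+ q (suc a) b = begin
  qint q (suc (a ℕ.+ b))                        ≡⟨ qint-suc q (a ℕ.+ b) ⟩
  1ℚ + q * qint q (a ℕ.+ b)                     ≡⟨ cong (λ z → 1ℚ + q * z) (qint-+ q a b) ⟩
  1ℚ + q * (qint q a + q ^ℚ a * qint q b)
    ≡⟨ solve 4 (λ q x p z → con 1ℚ :+ q :* (x :+ p :* z) := (con 1ℚ :+ q :* x) :+ (q :* p) :* z) refl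
             q (qint q a) (q ^ℚ a) (qint q b) ⟩
  (1ℚ + q * qint q a) + (q * q ^ℚ a) * qint q b ≡⟨ cong (_+ (q * q ^ℚ a) * qint q b) (sym (qint-suc q a)) ⟩
  qint q (suc a) + (q * q ^ℚ a) * qint q b      ∎
  where open ≡-Reasoning

qint-geometric : ∀ q j → (1ℚ - q) * qint q j ≡ 1ℚ - q ^ℚ j
qint-geometric q zero    = trans (ℚP.*-zeroʳ (1ℚ - q)) (solve 0 (con 0ℚ := con 1ℚ :- con 1ℚ) refl)
qint-geometric q (suc j) = begin
  (1ℚ - q) * qint q (suc j)            ≡⟨ cong ((1ℚ - q) *_) (qint-suc q j) ⟩
  (1ℚ - q) * (1ℚ + q * qint q j)
    ≡⟨ solve 2 (λ q z → (con 1ℚ :- q) :* (con 1ℚ :+ q :* z) := (con 1ℚ :- q) :+ q :* ((con 1ℚ :- q) :* z)) refl q (qint q j) ⟩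
  (1ℚ - q) + q * ((1ℚ - q) * qint q j) ≡⟨ cong (λ z → (1ℚ - q) + q * z) (qint-geometric q j) ⟩
  (1ℚ - q) + q * (1ℚ - q ^ℚ j)
    ≡⟨ solve 2 (λ q p → (con 1ℚ :- q) :+ q :* (con 1ℚ :- p) := con 1ℚ :- q :* p) refl q (q ^ℚ j) ⟩
  1ℚ - q * q ^ℚ j                      ∎
  where open ≡-Reasoning

∣^ℚ∣ : ∀ q j → ∣ q ^ℚ j ∣ ≡ ∣ q ∣ ^ℚ j
∣^ℚ∣ q zero    = refl
∣^ℚ∣ q (suc j) = trans (ℚP.∣p*q∣≡∣p∣*∣q∣ q (q ^ℚ j)) (cong (∣ q ∣ *_) (∣^ℚ∣ q j))

module _ (a : ℚ) (0≤a : 0ℚ ℚ.≤ a) where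
  private instance
    a-nonNegative : ℚ.NonNegative a
    a-nonNegative = ℚ.nonNegative 0≤a

  ^ℚ-bounded : a ℚ.< 1ℚ → ∀ i → (0ℚ ℚ.≤ a ^ℚ i) × (a ^ℚ i ℚ.≤ 1ℚ)
  ^ℚ-bounded a<1 zero    = ℚP.<⇒≤ (ℚP.positive⁻¹ 1ℚ) , ℚP.≤-refl
  ^ℚ-bounded a<1 (suc i) = let (0≤aⁱ , aⁱ≤1) = ^ℚ-bounded a<1 i in
    ℚP.≤-trans (ℚP.≤-reflexive (sym (ℚP.*-zeroʳ a))) (ℚP.*-monoˡ-≤-nonNeg a 0≤aⁱ) ,
    ℚP.≤-trans (ℚP.*-monoˡ-≤-nonNeg a aⁱ≤1) (ℚP.≤-trans (ℚP.≤-reflexive (ℚP.*-identityʳ a)) (ℚP.<⇒≤ a<1))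

  ^ℚ-suc-<1 : a ℚ.< 1ℚ → ∀ i → a ^ℚ suc i ℚ.< 1ℚ
  ^ℚ-suc-<1 a<1 i = ℚP.≤-<-trans (ℚP.*-monoˡ-≤-nonNeg a (proj₂ (^ℚ-bounded a<1 i)))
                                 (ℚP.≤-<-trans (ℚP.≤-reflexive (ℚP.*-identityʳ a)) a<1)

  ^ℚ-≥1 : 1ℚ ℚ.< a → ∀ i → 1ℚ ℚ.≤ a ^ℚ i
  ^ℚ-≥1 1<a zero    = ℚP.≤-refl
  ^ℚ-≥1 1<a (suc i) = ℚP.≤-trans (ℚP.<⇒≤ 1<a)
    (ℚP.≤-trans (ℚP.≤-reflexive (sym (ℚP.*-identityʳ a))) (ℚP.*-monoˡ-≤-nonNeg a (^ℚ-≥1 1<a i)))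

  ^ℚ-suc->1 : 1ℚ ℚ.< a → ∀ i → 1ℚ ℚ.< a ^ℚ suc i
  ^ℚ-suc->1 1<a i = ℚP.<-≤-trans 1<a
    (ℚP.≤-trans (ℚP.≤-reflexive (sym (ℚP.*-identityʳ a))) (ℚP.*-monoˡ-≤-nonNeg a (^ℚ-≥1 1<a i)))

qint-1-pos : ∀ j → 0ℚ ℚ.< qint 1ℚ (suc j)
qint-1-pos j = ℚP.<-≤-trans (ℚP.positive⁻¹ 1ℚ) (begin
  1ℚ                     ≡⟨ sym (ℚP.+-identityʳ 1ℚ) ⟩
  1ℚ + 0ℚ                ≤⟨ ℚP.+-monoʳ-≤ 1ℚ (nonNeg j) ⟩
  1ℚ + qint 1ℚ j         ≡⟨ cong (1ℚ +_) (sym (ℚP.*-identityˡ (qint 1ℚ j))) ⟩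
  1ℚ + 1ℚ * qint 1ℚ j    ≡⟨ sym (qint-suc 1ℚ j) ⟩
  qint 1ℚ (suc j)        ∎)
  where
  open ℚP.≤-Reasoning
  nonNeg : ∀ j → 0ℚ ℚ.≤ qint 1ℚ j
  nonNeg zero    = ℚP.≤-refl
  nonNeg (suc j) = ℚP.<⇒≤ (qint-1-pos j)

qint-≡0⇒∣∣^ℚ≡1 : ∀ w j → qint w (suc j) ≡ 0ℚ → ∣ w ∣ ^ℚ suc j ≡ 1ℚ
qint-≡0⇒∣∣^ℚ≡1 w j [j+1]≡0 = begin
  ∣ w ∣ ^ℚ suc j                     ≡⟨ sym (∣^ℚ∣ w (suc j)) ⟩
  ∣ w ^ℚ suc j ∣                     ≡⟨ cong ∣_∣ (solve 1 (λ p → p := con 1ℚ :- (con 1ℚ :- p)) refl (w ^ℚ suc j)) ⟩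
  ∣ 1ℚ - (1ℚ - w ^ℚ suc j) ∣         ≡⟨ cong (λ z → ∣ 1ℚ - z ∣) (sym (qint-geometric w (suc j))) ⟩
  ∣ 1ℚ - (1ℚ - w) * qint w (suc j) ∣ ≡⟨ cong (λ z → ∣ 1ℚ - (1ℚ - w) * z ∣) [j+1]≡0 ⟩
  ∣ 1ℚ - (1ℚ - w) * 0ℚ ∣             ≡⟨ cong ∣_∣ (solve 1 (λ x → con 1ℚ :- x :* con 0ℚ := con 1ℚ) refl (1ℚ - w)) ⟩
  1ℚ                                 ∎
  where open ≡-Reasoning

-- A vanishing q-integer forces ∣ w ∣ = 1, and [j+1]_1 = j + 1 ≠ 0.
qint-≢0 : ∀ w → w ≢ - 1ℚ → ∀ j → qint w (suc j) ≢ 0ℚ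
qint-≢0 w w≢-1 j [j+1]≡0 with ℚP.<-cmp ∣ w ∣ 1ℚ
... | tri< ∣w∣<1 _ _ =
  ℚP.<-irrefl (qint-≡0⇒∣∣^ℚ≡1 w j [j+1]≡0) (^ℚ-suc-<1 ∣ w ∣ (ℚP.0≤∣p∣ w) ∣w∣<1 j)
... | tri> _ _ ∣w∣>1 =
  ℚP.<-irrefl (sym (qint-≡0⇒∣∣^ℚ≡1 w j [j+1]≡0)) (^ℚ-suc->1 ∣ w ∣ (ℚP.0≤∣p∣ w) ∣w∣>1 j)
... | tri≈ _ ∣w∣≡1 _ with ℚP.∣p∣≡p∨∣p∣≡-p w
...   | inj₁ ∣w∣≡w  =
  ℚP.<-irrefl (sym (subst (λ z → qint z (suc j) ≡ 0ℚ) (trans (sym ∣w∣≡w) ∣w∣≡1) [j+1]≡0)) (qint-1-pos j)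
...   | inj₂ ∣w∣≡-w = w≢-1 (trans (solve 1 (λ x → x := :- (:- x)) refl w) (cong -_ (trans (sym ∣w∣≡-w) ∣w∣≡1)))

Π[]-map : ∀ (g : ℕ → ℕ) xs (f : ℕ → ℚ) → Π[ L.map g xs ] f ≡ Π[ xs ] (λ k → f (g k))
Π[]-map g []       f = refl
Π[]-map g (x ∷ xs) f = cong (f (g x) *_) (Π[]-map g xs f)

Π[]-++ : ∀ xs ys (f : ℕ → ℚ) → Π[ xs ++ ys ] f ≡ Π[ xs ] f * Π[ ys ] f
Π[]-++ []       ys f = sym (ℚP.*-identityˡ _)
Π[]-++ (x ∷ xs) ys f = trans (cong (f x *_) (Π[]-++ xs ys f)) (sym (ℚP.*-assoc (f x) _ _))

qfact-suc : ∀ q n → qfact q (suc n) ≡ qfact q n * qint q (suc n)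
qfact-suc q n = begin
  Π[ L.map (1 ℕ.+_) (upTo (suc n)) ] (qint q)           ≡⟨ Π[]-map (1 ℕ.+_) (upTo (suc n)) (qint q) ⟩
  Π[ upTo (suc n) ] (λ k → qint q (suc k))               ≡⟨ cong (λ l → Π[ l ] (λ k → qint q (suc k))) (sym (LP.upTo-∷ʳ n)) ⟩
  Π[ upTo n L.∷ʳ n ] (λ k → qint q (suc k))              ≡⟨ Π[]-++ (upTo n) (n ∷ []) (λ k → qint q (suc k)) ⟩
  Π[ upTo n ] (λ k → qint q (suc k)) * (qint q (suc n) * 1ℚ)
    ≡⟨ cong₂ _*_ (sym (Π[]-map (1 ℕ.+_) (upTo n) (qint q))) (ℚP.*-identityʳ (qint q (suc n))) ⟩
  qfact q n * qint q (suc n)                             ∎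
  where open ≡-Reasoning

qfact-≢0 : ∀ w → w ≢ - 1ℚ → ∀ n → qfact w n ≢ 0ℚ
qfact-≢0 w w≢-1 zero    ()
qfact-≢0 w w≢-1 (suc n) e =
  *-≢0 (qfact w n) (qint w (suc n)) (qfact-≢0 w w≢-1 n) (qint-≢0 w w≢-1 n) (trans (sym (qfact-suc w n)) e)

module _ (w : ℚ) where
  open ≡-Reasoning

  private
    [_]! : ℕ → ℚ
    [ n ]! = qfact w n

  gaussian-qfact : ∀ n k → k ≤ n → gaussian w n k * ([ k ]! * [ n ∸ k ]!) ≡ [ n ]!
  gaussian-suc-qfact : ∀ n k → k ≤ n → gaussian w n (suc k) * ([ suc k ]! * [ n ∸ k ]!) ≡ [ n ]! * qint w (n ∸ k)

  gaussian-qfact zero    zero    z≤n = trans (ℚP.*-identityˡ _) (ℚP.*-identityˡ 1ℚ)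
  gaussian-qfact (suc n) zero    z≤n =
    trans (cong (_* (1ℚ * [ suc n ]!)) (gaussian-zero w (suc n))) (trans (ℚP.*-identityˡ _) (ℚP.*-identityˡ _))
  gaussian-qfact (suc n) (suc k) (s≤s k≤n) = begin
    gaussian w (suc n) (suc k) * ([ suc k ]! * [ n ∸ k ]!)
      ≡⟨ cong₂ (λ g f → g * (f * [ n ∸ k ]!)) (gaussian-suc w n k) (qfact-suc w k) ⟩
    (X + P * Y) * (([ k ]! * A) * [ n ∸ k ]!)
      ≡⟨ solve 6 (λ X P Y f a g → (X :+ P :* Y) :* ((f :* a) :* g) := (X :* (f :* g)) :* a :+ P :* (Y :* ((f :* a) :* g)))
               refl X P Y [ k ]! A [ n ∸ k ]! ⟩
    (X * ([ k ]! * [ n ∸ k ]!)) * A + P * (Y * (([ k ]! * A) * [ n ∸ k ]!))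
      ≡⟨ cong₂ (λ a b → a * A + P * b) (gaussian-qfact n k k≤n)
               (trans (cong (λ f → Y * (f * [ n ∸ k ]!)) (sym (qfact-suc w k))) (gaussian-suc-qfact n k k≤n)) ⟩
    [ n ]! * A + P * ([ n ]! * B)
      ≡⟨ solve 4 (λ q a p b → q :* a :+ p :* (q :* b) := q :* (a :+ p :* b)) refl [ n ]! A P B ⟩
    [ n ]! * (A + P * B)
      ≡⟨ cong ([ n ]! *_) (sym (qint-+ w (suc k) (n ∸ k))) ⟩
    [ n ]! * qint w (suc (k ℕ.+ (n ∸ k)))
      ≡⟨ cong (λ z → [ n ]! * qint w (suc z)) (ℕP.m+[n∸m]≡n k≤n) ⟩
    [ n ]! * qint w (suc n)
      ≡⟨ sym (qfact-suc w n) ⟩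
    [ suc n ]! ∎
    where
    X Y P A B : ℚ
    X = gaussian w n k
    Y = gaussian w n (suc k)
    P = w ^ℚ suc k
    A = qint w (suc k)
    B = qint w (n ∸ k)

  gaussian-suc-qfact n k k≤n with ℕP.m≤n⇒m<n∨m≡n k≤n
  ... | inj₂ refl = begin
    gaussian w k (suc k) * ([ suc k ]! * [ k ∸ k ]!) ≡⟨ cong (_* ([ suc k ]! * [ k ∸ k ]!)) (gaussian-> w k (suc k) ℕP.≤-refl) ⟩
    0ℚ * ([ suc k ]! * [ k ∸ k ]!)                   ≡⟨ ℚP.*-zeroˡ ([ suc k ]! * [ k ∸ k ]!) ⟩
    0ℚ                                               ≡⟨ sym (ℚP.*-zeroʳ [ k ]!) ⟩
    [ k ]! * qint w 0                                ≡⟨ cong (λ z → [ k ]! * qint w z) (sym (ℕP.n∸n≡0 k)) ⟩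
    [ k ]! * qint w (k ∸ k)                          ∎
  ... | inj₁ k<n = begin
    Y * ([ suc k ]! * [ n ∸ k ]!)              ≡⟨ cong (λ z → Y * ([ suc k ]! * [ z ]!)) n∸k≡1+d ⟩
    Y * ([ suc k ]! * [ suc d ]!)              ≡⟨ cong (λ z → Y * ([ suc k ]! * z)) (qfact-suc w d) ⟩
    Y * ([ suc k ]! * ([ d ]! * qint w (suc d)))
      ≡⟨ solve 4 (λ y f g b → y :* (f :* (g :* b)) := (y :* (f :* g)) :* b) refl Y [ suc k ]! [ d ]! (qint w (suc d)) ⟩
    (Y * ([ suc k ]! * [ d ]!)) * qint w (suc d) ≡⟨ cong₂ (λ a z → a * qint w z) (gaussian-qfact n (suc k) k<n) (sym n∸k≡1+d) ⟩
    [ n ]! * qint w (n ∸ k)                    ∎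
    where
    Y : ℚ
    Y = gaussian w n (suc k)
    d : ℕ
    d = n ∸ suc k
    n∸k≡1+d : n ∸ k ≡ suc d
    n∸k≡1+d = ℕP.+-∸-assoc 1 k<n

  qbinom≡gaussian : w ≢ - 1ℚ → ∀ n k → k ≤ n → qbinom w n k ≡ gaussian w n k
  qbinom≡gaussian w≢-1 n k k≤n = div-unique [ n ]! ([ k ]! * [ n ∸ k ]!) (gaussian w n k)
    (*-≢0 _ _ (qfact-≢0 w w≢-1 k) (qfact-≢0 w w≢-1 (n ∸ k))) (gaussian-qfact n k k≤n)

-- The recursion for η

triangle≡C2 : ∀ n → triangle n ≡ n C 2
triangle≡C2 zero    = refl
triangle≡C2 (suc n) = trans (cong₂ ℕ._+_ (sym (nC1≡n n)) (triangle≡C2 n)) (nCk+nC[k+1]≡[n+1]C[k+1] n 1)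

triangle-double : ∀ d → triangle d ℕ.* 2 ℕ.+ d ≡ d ℕ.* d
triangle-double zero    = refl
triangle-double (suc d) = begin
  (d ℕ.+ triangle d) ℕ.* 2 ℕ.+ suc d          ≡⟨ reassoc d (triangle d) ⟩
  (triangle d ℕ.* 2 ℕ.+ d) ℕ.+ (suc d ℕ.+ d)  ≡⟨ cong (ℕ._+ (suc d ℕ.+ d)) (triangle-double d) ⟩
  d ℕ.* d ℕ.+ (suc d ℕ.+ d)                   ≡⟨ square-suc d ⟩
  suc d ℕ.* suc d                             ∎
  where
  open ≡-Reasoning
  reassoc : ∀ d t → (d ℕ.+ t) ℕ.* 2 ℕ.+ suc d ≡ (t ℕ.* 2 ℕ.+ d) ℕ.+ (suc d ℕ.+ d)
  reassoc = ℕSolver.solve-∀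
  square-suc : ∀ d → d ℕ.* d ℕ.+ (suc d ℕ.+ d) ≡ suc d ℕ.* suc d
  square-suc = ℕSolver.solve-∀

triangle-+ : ∀ a b → triangle (a ℕ.+ b) ≡ triangle a ℕ.+ a ℕ.* b ℕ.+ triangle b
triangle-+ zero    b = refl
triangle-+ (suc a) b = trans (cong ((a ℕ.+ b) ℕ.+_) (triangle-+ a b)) (reassoc a b (triangle a) (triangle b))
  where
  reassoc : ∀ a b ta tb → (a ℕ.+ b) ℕ.+ (ta ℕ.+ a ℕ.* b ℕ.+ tb) ≡ (a ℕ.+ ta) ℕ.+ suc a ℕ.* b ℕ.+ tb
  reassoc = ℕSolver.solve-∀

-- The exponent of (1 + y) in the recursion, for n = m + 1 and k = j + 1.
exponent-+-triangle : ∀ m j → j < m → ((m ∸ j) ℕ.* (m ℕ.+ suc j)) DM./ 2 ℕ.+ triangle (suc j) ≡ triangle (suc m)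
exponent-+-triangle m j j<m = begin
  (d ℕ.* (m ℕ.+ suc j)) DM./ 2 ℕ.+ triangle (suc j)
    ≡⟨ cong (λ z → (d ℕ.* (z ℕ.+ suc j)) DM./ 2 ℕ.+ triangle (suc j)) (sym j+d≡m) ⟩
  (d ℕ.* (j ℕ.+ d ℕ.+ suc j)) DM./ 2 ℕ.+ triangle (suc j)
    ≡⟨ cong (λ z → z DM./ 2 ℕ.+ triangle (suc j)) doubled ⟩
  ((suc j ℕ.* d ℕ.+ triangle d) ℕ.* 2) DM./ 2 ℕ.+ triangle (suc j)
    ≡⟨ cong (ℕ._+ triangle (suc j)) (DM.m*n/n≡m (suc j ℕ.* d ℕ.+ triangle d) 2) ⟩
  suc j ℕ.* d ℕ.+ triangle d ℕ.+ triangle (suc j)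
    ≡⟨ rotate (suc j ℕ.* d) (triangle d) (triangle (suc j)) ⟩
  triangle (suc j) ℕ.+ suc j ℕ.* d ℕ.+ triangle d
    ≡⟨ sym (triangle-+ (suc j) d) ⟩
  triangle (suc (j ℕ.+ d))
    ≡⟨ cong (λ z → triangle (suc z)) j+d≡m ⟩
  triangle (suc m) ∎
  where
  open ≡-Reasoning
  d : ℕ
  d = m ∸ j
  j+d≡m : j ℕ.+ d ≡ m
  j+d≡m = ℕP.m+[n∸m]≡n (ℕP.<⇒≤ j<m)
  rotate : ∀ x y z → x ℕ.+ y ℕ.+ z ≡ z ℕ.+ x ℕ.+ y
  rotate = ℕSolver.solve-∀
  expand : ∀ j d → d ℕ.* (j ℕ.+ d ℕ.+ suc j) ≡ d ℕ.* j ℕ.* 2 ℕ.+ (d ℕ.* d ℕ.+ d)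
  expand = ℕSolver.solve-∀
  collect : ∀ j d t → d ℕ.* j ℕ.* 2 ℕ.+ (t ℕ.* 2 ℕ.+ d ℕ.+ d) ≡ (suc j ℕ.* d ℕ.+ t) ℕ.* 2
  collect = ℕSolver.solve-∀
  doubled : d ℕ.* (j ℕ.+ d ℕ.+ suc j) ≡ (suc j ℕ.* d ℕ.+ triangle d) ℕ.* 2
  doubled = trans (expand j d)
    (trans (cong (λ z → d ℕ.* j ℕ.* 2 ℕ.+ (z ℕ.+ d)) (sym (triangle-double d))) (collect j d (triangle d)))

Σ[]-cong-upTo : ∀ m {h h′ : ℕ → ℚ} → (∀ j → j < m → h j ≡ h′ j) → Σ[ upTo m ] h ≡ Σ[ upTo m ] h′
Σ[]-cong-upTo zero    e = refl
Σ[]-cong-upTo (suc m) {h} {h′} e = trans (Σ[]-upTo-suc m h)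
  (trans (cong₂ _+_ (Σ[]-cong-upTo m (λ j j<m → e j (ℕP.m<n⇒m<1+n j<m))) (e m ℕP.≤-refl))
         (sym (Σ[]-upTo-suc m h′)))

Σ[]-cong-1⋯ : ∀ m (f g : ℕ → ℚ) → (∀ j → j < m → f (suc j) ≡ g (suc j)) →
  Σ[ [ 1 ⋯ suc m ∸ 1 ] ] f ≡ Σ[ [ 1 ⋯ suc m ∸ 1 ] ] g
Σ[]-cong-1⋯ m f g e =
  trans (ΣL-map (1 ℕ.+_) (upTo m) f) (trans (Σ[]-cong-upTo m e) (sym (ΣL-map (1 ℕ.+_) (upTo m) g)))

module _ (sc? : ∀ {n} (D : Digraph n) → Dec (StronglyConnected D))
         (y : ℚ) (y≢0 : y ≢ 0ℚ) (y≢-1 : y ≢ - 1ℚ) where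
  open ≡-Reasoning

  w u : ℚ
  w = 1ℚ ÷' y
  u = 1ℚ ÷' (y * y)

  u*y≡w : u * y ≡ w
  u*y≡w = sym (div-unique 1ℚ y (u * y) y≢0 (begin
    (u * y) * y     ≡⟨ solve 2 (λ y u → (u :* y) :* y := (y :* y) :* u) refl y u ⟩
    (y * y) * u     ≡⟨ div-inverseʳ (y * y) (*-≢0 y y y≢0 y≢0) ⟩
    1ℚ              ∎))

  q≡w : q u y ≡ w
  q≡w = trans (cong (λ z → (1ℚ + z) ÷' (1ℚ + y)) u*y≡w) (div-unique (1ℚ + w) (1ℚ + y) w 1+y≢0 (begin
    w * (1ℚ + y)    ≡⟨ solve 2 (λ w y → w :* (con 1ℚ :+ y) := w :+ y :* w) refl w y ⟩
    w + y * w       ≡⟨ cong (w +_) (div-inverseʳ y y≢0) ⟩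
    w + 1ℚ          ≡⟨ ℚP.+-comm w 1ℚ ⟩
    1ℚ + w          ∎))
    where
    1+y≢0 : 1ℚ + y ≢ 0ℚ
    1+y≢0 1+y≡0 = y≢-1 (begin
      y                    ≡⟨ solve 1 (λ y → y := (con 1ℚ :+ y) :+ (:- con 1ℚ)) refl y ⟩
      (1ℚ + y) + - 1ℚ      ≡⟨ cong (_+ - 1ℚ) 1+y≡0 ⟩
      0ℚ + - 1ℚ            ≡⟨ ℚP.+-identityˡ (- 1ℚ) ⟩
      - 1ℚ                 ∎)

  w≢-1 : w ≢ - 1ℚ
  w≢-1 w≡-1 = y≢-1 (begin
    y                    ≡⟨ solve 1 (λ y → y := :- (y :* (:- con 1ℚ))) refl y ⟩
    - (y * - 1ℚ)         ≡⟨ cong (λ z → - (y * z)) (sym w≡-1) ⟩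
    - (y * w)            ≡⟨ cong -_ (div-inverseʳ y y≢0) ⟩
    - 1ℚ                 ∎)

  η-summand : ∀ fuel m j → j < m →
    etaF u y fuel (suc j) ≡ (1ℚ + y) ^ℚ (suc j C 2) * strongTournamentSum w sc? (suc j) →
    ((qbinom (q u y) (suc m) (suc j) * (1ℚ + u * y) ^ℚ ((m ∸ j) C 2))
      * (1ℚ + y) ^ℚ (((m ∸ j) ℕ.* (m ℕ.+ suc j)) DM./ 2)) * etaF u y fuel (suc j)
    ≡ (1ℚ + y) ^ℚ (suc m C 2) * (componentWeight w sc? (suc m) (suc j) * gaussian w (suc m) (suc j))
  η-summand fuel m j j<m η-IH = begin
    ((qbinom (q u y) (suc m) (suc j) * (1ℚ + u * y) ^ℚ ((m ∸ j) C 2)) * Y ^ℚ e) * etaF u y fuel (suc j)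
      ≡⟨ cong₂ (λ a b → a * b)
           (cong₂ (λ g p → (g * p) * Y ^ℚ e)
             (trans (cong (λ z → qbinom z (suc m) (suc j)) q≡w) (qbinom≡gaussian w w≢-1 (suc m) (suc j) (ℕP.m≤n⇒m≤1+n j<m)))
             (cong₂ (λ a b → (1ℚ + a) ^ℚ b) u*y≡w (sym (triangle≡C2 (m ∸ j)))))
           η-IH ⟩
    ((G * (1ℚ + w) ^ℚ triangle (m ∸ j)) * Y ^ℚ e) * (Y ^ℚ (suc j C 2) * T)
      ≡⟨ solve 5 (λ G W Ye Yk T → ((G :* W) :* Ye) :* (Yk :* T) := (Ye :* Yk) :* ((T :* W) :* G))
               refl G ((1ℚ + w) ^ℚ triangle (m ∸ j)) (Y ^ℚ e) (Y ^ℚ (suc j C 2)) T ⟩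
    (Y ^ℚ e * Y ^ℚ (suc j C 2)) * ((T * (1ℚ + w) ^ℚ triangle (m ∸ j)) * G)
      ≡⟨ cong (_* ((T * (1ℚ + w) ^ℚ triangle (m ∸ j)) * G)) (sym (^ℚ-distribˡ-+-* Y e (suc j C 2))) ⟩
    Y ^ℚ (e ℕ.+ suc j C 2) * ((T * (1ℚ + w) ^ℚ triangle (m ∸ j)) * G)
      ≡⟨ cong (λ z → Y ^ℚ z * ((T * (1ℚ + w) ^ℚ triangle (m ∸ j)) * G))
           (trans (cong (e ℕ.+_) (sym (triangle≡C2 (suc j)))) (trans (exponent-+-triangle m j j<m) (triangle≡C2 (suc m)))) ⟩
    Y ^ℚ (suc m C 2) * ((T * (1ℚ + w) ^ℚ triangle (m ∸ j)) * G) ∎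
    where
    Y G T : ℚ
    Y = 1ℚ + y
    G = gaussian w (suc m) (suc j)
    T = strongTournamentSum w sc? (suc j)
    e : ℕ
    e = ((m ∸ j) ℕ.* (m ℕ.+ suc j)) DM./ 2

  η≡strong : ∀ fuel m → m < fuel → etaF u y fuel (suc m) ≡ (1ℚ + y) ^ℚ (suc m C 2) * strongTournamentSum w sc? (suc m)
  η≡strong (suc fuel) m (s≤s m≤fuel) = begin
    (Yₙ * (1ℚ + u * y) ^ℚ (n C 2)) - Σ[ [ 1 ⋯ n ∸ 1 ] ] summand
      ≡⟨ cong₂ (λ a b → (Yₙ * a) - b) (cong₂ (λ a b → (1ℚ + a) ^ℚ b) u*y≡w (sym (triangle≡C2 n)))
           (Σ[]-cong-1⋯ m summand (λ k → Yₙ * g k)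
             (λ j j<m → η-summand fuel m j j<m (η≡strong fuel j (ℕP.<-≤-trans j<m m≤fuel)))) ⟩
    (Yₙ * (1ℚ + w) ^ℚ triangle n) - Σ[ [ 1 ⋯ n ∸ 1 ] ] (λ k → Yₙ * g k)
      ≡⟨ cong₂ (λ a b → (Yₙ * a) - b) (tournament-recurrence w sc? m) (homogeneous (linear-ΣL [ 1 ⋯ n ∸ 1 ]) Yₙ g) ⟩
    (Yₙ * (Σg + T)) - Yₙ * Σg
      ≡⟨ solve 3 (λ Y s t → (Y :* (s :+ t)) :- Y :* s := Y :* t) refl Yₙ Σg T ⟩
    Yₙ * T ∎
    where
    n : ℕ
    n = suc m
    Yₙ T : ℚ
    Yₙ = (1ℚ + y) ^ℚ (n C 2)
    T = strongTournamentSum w sc? n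
    summand : ℕ → ℚ
    summand k = ((qbinom (q u y) n k * (1ℚ + u * y) ^ℚ ((n ∸ k) C 2))
                  * (1ℚ + y) ^ℚ (((n ∸ k) ℕ.* (n ℕ.+ k ∸ 1)) DM./ 2)) * etaF u y fuel k
    g : ℕ → ℚ
    g k = componentWeight w sc? n k * gaussian w n k
    Σg : ℚ
    Σg = Σ[ [ 1 ⋯ n ∸ 1 ] ] g

proposition3p8 : (sc? : ∀ {n} (D : Digraph n) → Dec (StronglyConnected D))
                 → (n : ℕ) → 1 ≤ n → (y : ℚ) → y ≢ 0ℚ → y ≢ - 1ℚ
                 → η (1ℚ ÷' (y * y)) y n ≡ ((1ℚ + y) ^ℚ (n C 2)) * t sc? n (1ℚ ÷' y)
proposition3p8 sc? (suc m) (s≤s z≤n) y y≢0 y≢-1 = begin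
  η (1ℚ ÷' (y * y)) y (suc m)
    ≡⟨ η≡strong sc? y y≢0 y≢-1 (suc m) m ℕP.≤-refl ⟩
  (1ℚ + y) ^ℚ (suc m C 2) * strongTournamentSum (1ℚ ÷' y) sc? (suc m)
    ≡⟨ cong ((1ℚ + y) ^ℚ (suc m C 2) *_) (sym (t≡strongTournamentSum sc? (suc m) (1ℚ ÷' y))) ⟩
  (1ℚ + y) ^ℚ (suc m C 2) * t sc? (suc m) (1ℚ ÷' y) ∎
  where open ≡-Reasoning
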